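{- Let $q$ and $x$ be indeterminates. For $n\in\mathbb{N}$ let $[n]=\frac{1-q^n}{1-q}$ and $[n]!=[1][2]\cdots[n]$ (with $[0]!=1$), and let $(y;q)_n=\prod_{j=0}^{n-1}(1-q^jy)$. Define the $q$-Stirling numbers of the second kind $S[n,k]$ by $S[0,k]=[k=0]$, $S[n,0]=[n=0]$ and $S[n,k]=S[n-1,k-1]+[k]\,S[n-1,k]$ for $n,k\ge1$, and let $\Phi_n(x)=\sum_{k=0}^n q^{\binom{k}{2}}S[n,k]\,x^k$. Then for every $n\ge1$, $$\det\left(\Phi_{i+j}(x)\right)_{i,j=0}^{n-1}=q^{2\binom{n}{3}}x^{\binom{n}{2}}\prod_{j=0}^{n-1}\Big([j]!\,((1-q)x;q)_j\Big)$$ and $$\det\left(\Phi_{i+j+1}(x)\right)_{i,j=0}^{n-1}=q^{2\binom{n+1}{3}}x^{\binom{n+1}{2}}\prod_{j=0}^{n-1}\Big([j]!\,((1-q)x;q)_j\Big).$$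
   Context: $[k=0]$ denotes the Iverson bracket (1 if $k=0$, else 0). -}

module Defs where

open import Level using (Level)
open import Algebra.Bundles using (CommutativeRing)
open import Data.Nat using (ℕ; zero; suc)
open import Data.Fin using (Fin; zero; suc; punchIn)

-- An identity between polynomials in the indeterminates q, x (with integer
-- coefficients) is the same as the identity holding for all elements q, x
-- of all commutative rings R.
module Over {c ℓ : Level} (R : CommutativeRing c ℓ) where
  open CommutativeRing R public using (Carrier; _≈_; _+_; _*_; -_; _-_; 0#; 1#)

  pow : Carrier → ℕ → Carrier
  pow a zero    = 1#
  pow a (suc n) = pow a n * a

  sumTo : ℕ → (ℕ → Carrier) → Carrier
  sumTo zero    f = 0#
  sumTo (suc n) f = sumTo n f + f n

  prodTo : ℕ → (ℕ → Carrier) → Carrier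
  prodTo zero    f = 1#
  prodTo (suc n) f = prodTo n f * f n

  sumFin : (n : ℕ) → (Fin n → Carrier) → Carrier
  sumFin zero    f = 0#
  sumFin (suc n) f = f zero + sumFin n (λ i → f (suc i))

  sign : ℕ → Carrier
  sign zero    = 1#
  sign (suc j) = - sign j

  det : (n : ℕ) → (Fin n → Fin n → Carrier) → Carrier
  det zero    M = 1#
  det (suc n) M =
    sumFin (suc n) (λ j → sign (Data.Fin.toℕ j) * M zero j
                          * det n (λ i k → M (suc i) (punchIn j k)))

  module _ (q : Carrier) where

    -- [n] = (1 - q^n)/(1 - q) = 1 + q + … + q^(n-1)
    qint : ℕ → Carrier
    qint n = sumTo n (λ i → pow q i)

    qfact : ℕ → Carrier
    qfact n = prodTo n (λ i → qint (suc i))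

    qpoch : Carrier → ℕ → Carrier
    qpoch y n = prodTo n (λ j → 1# - pow q j * y)

    S : ℕ → ℕ → Carrier
    S zero    zero    = 1#
    S zero    (suc k) = 0#
    S (suc n) zero    = 0#
    S (suc n) (suc k) = S n k + qint (suc k) * S n (suc k)

    Φ : ℕ → Carrier → Carrier
    Φ n x = sumTo (suc n) (λ k → pow q (k C 2) * S n k * pow x k)
      where open import Data.Nat.Combinatorics using (_C_)

-- The Hankel matrix (Φ_{i+j+s}) factors as L · M with L = (S[i+s, k+s]) lower unitriangular and
-- M k j = moment (k+s) j, where moment k 0 = q^(k choose 2) x^k and
-- moment k (j+1) = moment (k+1) j + [k] moment k j.  A second lower unitriangular matrix, with entries
-- [n choose k] ζₙ^(n-k), turns M into an upper triangular U: the rows of U satisfy a three-term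
-- recurrence (as for orthogonal polynomials with moments M), so the vanishing of the first column
-- below the diagonal, an instance of the q-binomial theorem, propagates to the whole lower triangle,
-- and the diagonal obeys U (n+1) (n+1) = γₙ U n n with an explicit γₙ.  The determinant is then
-- the product of the γₙ.

module Submission where

open import Defs
open import Level using (Level)
open import Algebra.Bundles using (CommutativeRing)
open import Data.Nat as N using (ℕ; suc; _≤_)
open import Data.Nat.Combinatorics using (_C_)
open import Data.Fin using (Fin; toℕ)
open import Data.Product using (_×_)

open import Data.Nat as ℕ using (zero)
import Data.Nat.Properties as ℕ
open import Data.Nat.Combinatorics using (nC1≡n; nCk+nC[k+1]≡[n+1]C[k+1])
open import Data.Fin as Fin using (zero; suc; punchIn)
import Data.Fin.Properties as Fin
open import Data.Vec.Functional using (updateAt; removeAt; tail)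
open import Data.Vec.Functional.Properties using (updateAt-updates; updateAt-minimal; updateAt-id-local; map-updateAt)
open import Data.Product using (_,_)
open import Data.Sum using (inj₁; inj₂)
open import Data.Empty using (⊥-elim)
open import Data.Maybe using (Maybe; just; nothing)
open import Function using (_∘_; const)
open import Relation.Nullary using (yes; no)
import Relation.Binary.PropositionalEquality as ≡
open ≡ using (_≡_; _≢_)

-- The standard-library ring solver over an arbitrary commutative ring, with ℤ as coefficient ring so that
-- integer coefficients cancel during normalisation.
module IntegerRingSolver {c ℓ} (R : CommutativeRing c ℓ) where
  open import Data.Integer as ℤ using (ℤ; +_; -[1+_]; _⊖_; sign; ∣_∣; _◃_)
  import Data.Integer.Properties as ℤ
  open import Data.Sign as Sign using (Sign)
  open CommutativeRing R
  open import Algebra.Properties.Ring ring using (-‿involutive; -0#≈0#; -‿+-comm; -1*x≈-x)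
  open import Algebra.Properties.Semiring.Mult.TCOptimised semiring using (×-homo-+; ×1-homo-*) renaming (_×_ to _×ᵣ_)
  open import Algebra.Solver.Ring.AlmostCommutativeRing
    using (fromCommutativeRing; _-Raw-AlmostCommutative⟶_)
  open import Relation.Binary.Reasoning.Setoid setoid

  fromSign : Sign → Carrier
  fromSign Sign.+ = 1#
  fromSign Sign.- = - 1#

  fromℤ : ℤ → Carrier
  fromℤ (+ n)    = n ×ᵣ 1#
  fromℤ -[1+ n ] = - (suc n ×ᵣ 1#)

  fromℤ-◃ : ∀ s n → fromℤ (s ◃ n) ≈ fromSign s * (n ×ᵣ 1#)
  fromℤ-◃ s        zero    = sym (zeroʳ _)
  fromℤ-◃ Sign.+ (suc n) = sym (*-identityˡ _)
  fromℤ-◃ Sign.- (suc n) = sym (-1*x≈-x _)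

  fromℤ-sign : ∀ i → fromℤ i ≈ fromSign (sign i) * (∣ i ∣ ×ᵣ 1#)
  fromℤ-sign (+ n)    = sym (*-identityˡ _)
  fromℤ-sign -[1+ n ] = fromℤ-◃ Sign.- (suc n)

  fromSign-* : ∀ s t → fromSign (s Sign.* t) ≈ fromSign s * fromSign t
  fromSign-* Sign.+ t      = sym (*-identityˡ _)
  fromSign-* Sign.- Sign.+ = sym (*-identityʳ _)
  fromSign-* Sign.- Sign.- = sym (trans (-1*x≈-x _) (-‿involutive _))

  fromℤ-* : ∀ i j → fromℤ (i ℤ.* j) ≈ fromℤ i * fromℤ j
  fromℤ-* i j = begin
    fromℤ (i ℤ.* j)                                  ≈⟨ fromℤ-◃ (sign i Sign.* sign j) (∣ i ∣ ℕ.* ∣ j ∣) ⟩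
    fromSign (sign i Sign.* sign j) * ((∣ i ∣ ℕ.* ∣ j ∣) ×ᵣ 1#)
      ≈⟨ *-cong (fromSign-* (sign i) (sign j)) (×1-homo-* ∣ i ∣ ∣ j ∣) ⟩
    (fromSign (sign i) * fromSign (sign j)) * ((∣ i ∣ ×ᵣ 1#) * (∣ j ∣ ×ᵣ 1#))
      ≈⟨ interchange _ _ _ _ ⟩
    (fromSign (sign i) * (∣ i ∣ ×ᵣ 1#)) * (fromSign (sign j) * (∣ j ∣ ×ᵣ 1#))
      ≈⟨ *-cong (fromℤ-sign i) (fromℤ-sign j) ⟨
    fromℤ i * fromℤ j                                ∎
    where
    interchange : ∀ a b u v → (a * b) * (u * v) ≈ (a * u) * (b * v)
    interchange a b u v = begin
      (a * b) * (u * v) ≈⟨ *-assoc a b (u * v) ⟩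
      a * (b * (u * v)) ≈⟨ *-congˡ (*-assoc b u v) ⟨
      a * ((b * u) * v) ≈⟨ *-congˡ (*-congʳ (*-comm b u)) ⟩
      a * ((u * b) * v) ≈⟨ *-congˡ (*-assoc u b v) ⟩
      a * (u * (b * v)) ≈⟨ *-assoc a u (b * v) ⟨
      (a * u) * (b * v) ∎

  suc×1 : ∀ m → suc m ×ᵣ 1# ≈ 1# + m ×ᵣ 1#
  suc×1 = ×-homo-+ 1# 1

  fromℤ-⊖ : ∀ m n → fromℤ (m ⊖ n) ≈ m ×ᵣ 1# - n ×ᵣ 1#
  fromℤ-⊖ m zero = sym (trans (+-congˡ -0#≈0#) (+-identityʳ _))
  fromℤ-⊖ zero (suc n) = sym (+-identityˡ _)
  fromℤ-⊖ (suc m) (suc n) = begin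
    fromℤ (suc m ⊖ suc n)     ≡⟨ ≡.cong fromℤ (ℤ.[1+m]⊖[1+n]≡m⊖n m n) ⟩
    fromℤ (m ⊖ n)             ≈⟨ fromℤ-⊖ m n ⟩
    a - b                     ≈⟨ +-congʳ (+-identityˡ a) ⟨
    (0# + a) - b              ≈⟨ +-congʳ (+-congʳ (-‿inverseʳ 1#)) ⟨
    ((1# - 1#) + a) - b       ≈⟨ +-congʳ (+-assoc 1# (- 1#) a) ⟩
    (1# + (- 1# + a)) - b     ≈⟨ +-congʳ (+-congˡ (+-comm (- 1#) a)) ⟩
    (1# + (a - 1#)) - b       ≈⟨ +-congʳ (+-assoc 1# a (- 1#)) ⟨
    ((1# + a) - 1#) - b       ≈⟨ +-assoc (1# + a) (- 1#) (- b) ⟩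
    (1# + a) + (- 1# - b)     ≈⟨ +-congˡ (-‿+-comm 1# b) ⟩
    (1# + a) - (1# + b)       ≈⟨ +-cong (suc×1 m) (-‿cong (suc×1 n)) ⟨
    suc m ×ᵣ 1# - suc n ×ᵣ 1#   ∎
    where
    a = m ×ᵣ 1#
    b = n ×ᵣ 1#

  fromℤ-+ : ∀ i j → fromℤ (i ℤ.+ j) ≈ fromℤ i + fromℤ j
  fromℤ-+ (+ m)    (+ n)    = ×-homo-+ 1# m n
  fromℤ-+ (+ m)    -[1+ n ] = fromℤ-⊖ m (suc n)
  fromℤ-+ -[1+ m ] (+ n)    = trans (fromℤ-⊖ n (suc m)) (+-comm _ _)
  fromℤ-+ -[1+ m ] -[1+ n ] = begin
    - (suc (suc m ℕ.+ n) ×ᵣ 1#)               ≈⟨ -‿cong (suc×1 (suc m ℕ.+ n)) ⟩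
    - (1# + (suc m ℕ.+ n) ×ᵣ 1#)              ≈⟨ -‿cong (+-congˡ (×-homo-+ 1# (suc m) n)) ⟩
    - (1# + ((suc m ×ᵣ 1#) + (n ×ᵣ 1#)))       ≈⟨ -‿cong (+-congˡ (+-comm _ _)) ⟩
    - (1# + ((n ×ᵣ 1#) + (suc m ×ᵣ 1#)))       ≈⟨ -‿cong (+-assoc 1# _ _) ⟨
    - ((1# + n ×ᵣ 1#) + (suc m ×ᵣ 1#))         ≈⟨ -‿cong (+-congʳ (suc×1 n)) ⟨
    - ((suc n ×ᵣ 1#) + (suc m ×ᵣ 1#))          ≈⟨ -‿+-comm _ _ ⟨
    - (suc n ×ᵣ 1#) - (suc m ×ᵣ 1#)            ≈⟨ +-comm _ _ ⟩
    - (suc m ×ᵣ 1#) - (suc n ×ᵣ 1#)            ∎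

  fromℤ-neg : ∀ i → fromℤ (ℤ.- i) ≈ - fromℤ i
  fromℤ-neg (+ zero)  = sym -0#≈0#
  fromℤ-neg (+ suc n) = refl
  fromℤ-neg -[1+ n ]  = sym (-‿involutive _)

  private
    homomorphism : ℤ.+-*-rawRing -Raw-AlmostCommutative⟶ fromCommutativeRing R
    homomorphism = record
      { ⟦_⟧ = fromℤ ; +-homo = fromℤ-+ ; *-homo = fromℤ-* ; -‿homo = fromℤ-neg
      ; 0-homo = refl ; 1-homo = refl }

    coefficientEquality : ∀ i j → Maybe (fromℤ i ≈ fromℤ j)
    coefficientEquality i j with i ℤ.≟ j
    ... | yes ≡.refl = just refl
    ... | no _     = nothing

  open import Algebra.Solver.Ring ℤ.+-*-rawRing (fromCommutativeRing R) homomorphism coefficientEquality public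

  :0 :1 : ∀ {n} → Polynomial n
  :0 = con (ℤ.+ 0)
  :1 = con (ℤ.+ 1)

module Determinant {c ℓ} (R : CommutativeRing c ℓ) where
  open Over R
  open CommutativeRing R hiding (Carrier; _≈_; _+_; _*_; -_; _-_; 0#; 1#; zero)
  open import Algebra.Properties.Ring ring using (-‿involutive; -0#≈0#; -‿+-comm)
  open IntegerRingSolver R using (solve; _:+_; _:*_; :-_; _:=_; :0; :1)
  open import Relation.Binary.Reasoning.Setoid setoid

  Matrix : ℕ → Set c
  Matrix n = Fin n → Fin n → Carrier

  minor : ∀ {n} → Fin (suc n) → Matrix (suc n) → Matrix n
  minor j M i = removeAt (M (suc i)) j

  sumFin-cong : ∀ n (f g : Fin n → Carrier) → (∀ i → f i ≈ g i) → sumFin n f ≈ sumFin n g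
  sumFin-cong zero    f g f≈g = refl
  sumFin-cong (suc n) f g f≈g = +-cong (f≈g zero) (sumFin-cong n (f ∘ suc) (g ∘ suc) (f≈g ∘ suc))

  sumFin-zero : ∀ n (f : Fin n → Carrier) → (∀ i → f i ≈ 0#) → sumFin n f ≈ 0#
  sumFin-zero zero    f f≈0 = refl
  sumFin-zero (suc n) f f≈0 = trans (+-cong (f≈0 zero) (sumFin-zero n (f ∘ suc) (f≈0 ∘ suc))) (+-identityˡ 0#)

  sumFin-distrib-+ : ∀ n (f g : Fin n → Carrier) → sumFin n (λ i → f i + g i) ≈ sumFin n f + sumFin n g
  sumFin-distrib-+ zero    f g = sym (+-identityˡ 0#)
  sumFin-distrib-+ (suc n) f g = trans (+-congˡ (sumFin-distrib-+ n (f ∘ suc) (g ∘ suc)))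
    (solve 4 (λ a b c d → (a :+ b) :+ (c :+ d) := (a :+ c) :+ (b :+ d)) refl _ _ _ _)

  *-distribˡ-sumFin : ∀ n a (f : Fin n → Carrier) → a * sumFin n f ≈ sumFin n (λ i → a * f i)
  *-distribˡ-sumFin zero    a f = zeroʳ a
  *-distribˡ-sumFin (suc n) a f = trans (distribˡ a _ _) (+-congˡ (*-distribˡ-sumFin n a (f ∘ suc)))

  -‿distrib-sumFin : ∀ n (f : Fin n → Carrier) → - sumFin n f ≈ sumFin n (λ i → - f i)
  -‿distrib-sumFin zero    f = -0#≈0#
  -‿distrib-sumFin (suc n) f = trans (sym (-‿+-comm _ _)) (+-congˡ (-‿distrib-sumFin n (f ∘ suc)))

  -- Naming the summand of det (suc n) M lets the sumFin lemmas be applied to it: Agda cannot recover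
  -- the summand from a sum over Fin (suc n) once that sum has been unfolded.
  expansionTerm : ∀ n → Matrix (suc n) → Fin (suc n) → Carrier
  expansionTerm n M j = sign (toℕ j) * M zero j * det n (minor j M)

  det-cong : ∀ n {M N : Matrix n} → (∀ i j → M i j ≈ N i j) → det n M ≈ det n N
  det-cong zero    M≈N = refl
  det-cong (suc n) {M} {N} M≈N = sumFin-cong (suc n) (expansionTerm n M) (expansionTerm n N) λ j →
    *-cong (*-congˡ (M≈N zero j)) (det-cong n (λ i k → M≈N (suc i) (punchIn j k)))

  det-cong-≡ : ∀ n {M N : Matrix n} → (∀ i → M i ≡ N i) → det n M ≈ det n N
  det-cong-≡ n M≡N = det-cong n (λ i j → reflexive (≡.cong-app (M≡N i) j))

  minor-updateAt : ∀ {n} (j : Fin (suc n)) (M : Matrix (suc n)) s r i →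
    minor j (updateAt M (suc s) (const r)) i ≡ updateAt (minor j M) s (const (removeAt r j)) i
  minor-updateAt j M s r = map-updateAt {f = λ row → removeAt row j} {g = const r} (λ _ → ≡.refl) (tail M) s

  det-linear : ∀ n (M : Matrix n) s (w u v : Fin n → Carrier) a b → (∀ j → w j ≈ a * u j + b * v j) →
    det n (updateAt M s (const w)) ≈ a * det n (updateAt M s (const u)) + b * det n (updateAt M s (const v))
  det-linear (suc n) M s w u v a b w≈au+bv = begin
    sumFin (suc n) (expansionTerm n (Mr w))
      ≈⟨ sumFin-cong (suc n) _ (λ j → a * expansionTerm n (Mr u) j + b * expansionTerm n (Mr v) j) (termwise s) ⟩
    sumFin (suc n) (λ j → a * expansionTerm n (Mr u) j + b * expansionTerm n (Mr v) j)
      ≈⟨ sumFin-distrib-+ (suc n) (λ j → a * expansionTerm n (Mr u) j) (λ j → b * expansionTerm n (Mr v) j) ⟩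
    sumFin (suc n) (λ j → a * expansionTerm n (Mr u) j) + sumFin (suc n) (λ j → b * expansionTerm n (Mr v) j)
      ≈⟨ +-cong (*-distribˡ-sumFin (suc n) a (expansionTerm n (Mr u))) (*-distribˡ-sumFin (suc n) b (expansionTerm n (Mr v))) ⟨
    a * det (suc n) (Mr u) + b * det (suc n) (Mr v) ∎
    where
    Mr : (Fin (suc n) → Carrier) → Matrix (suc n)
    Mr r = updateAt M s (const r)
    termwise : ∀ s j → expansionTerm n (updateAt M s (const w)) j
                         ≈ a * expansionTerm n (updateAt M s (const u)) j + b * expansionTerm n (updateAt M s (const v)) j
    termwise zero j =
      trans (*-congʳ (*-congˡ (w≈au+bv j)))
        (solve 6 (λ a b σ x y d → σ :* (a :* x :+ b :* y) :* d := a :* (σ :* x :* d) :+ b :* (σ :* y :* d))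
               refl a b (sign (toℕ j)) (u j) (v j) (det n (minor j M)))
    termwise (suc s) j = begin
      sign (toℕ j) * M zero j * det n (minor j (updateAt M (suc s) (const w)))
        ≈⟨ *-congˡ (trans (det-cong-≡ n (minor-updateAt j M s w)) (det-linear n (minor j M) s _ _ _ a b (w≈au+bv ∘ punchIn j))) ⟩
      μ * (a * D u + b * D v)
        ≈⟨ solve 5 (λ a b μ x y → μ :* (a :* x :+ b :* y) := a :* (μ :* x) :+ b :* (μ :* y)) refl a b μ (D u) (D v) ⟩
      a * (μ * D u) + b * (μ * D v)
        ≈⟨ +-cong (*-congˡ (*-congˡ (det-cong-≡ n (minor-updateAt j M s u)))) (*-congˡ (*-congˡ (det-cong-≡ n (minor-updateAt j M s v)))) ⟨
      a * expansionTerm n (updateAt M (suc s) (const u)) j + b * expansionTerm n (updateAt M (suc s) (const v)) j ∎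
      where
      μ = sign (toℕ j) * M zero j
      D : (Fin (suc n) → Carrier) → Carrier
      D r = det n (updateAt (minor j M) s (const (removeAt r j)))

  det-zeroRow : ∀ n (M : Matrix n) s (w : Fin n → Carrier) → (∀ j → w j ≈ 0#) → det n (updateAt M s (const w)) ≈ 0#
  det-zeroRow n M s w w≈0 = begin
    det n (updateAt M s (const w))  ≈⟨ det-linear n M s w w w 0# 0# (λ j → trans (w≈0 j) (zero≈0w+0w (w j))) ⟩
    0# * D + 0# * D                 ≈⟨ solve 1 (λ d → :0 :* d :+ :0 :* d := :0) refl D ⟩
    0#                              ∎
    where
    D = det n (updateAt M s (const w))
    zero≈0w+0w : ∀ x → 0# ≈ 0# * x + 0# * x
    zero≈0w+0w = solve 1 (λ x → :0 := :0 :* x :+ :0 :* x) refl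

  det-rowCombination : ∀ n (M : Matrix n) s m (g : Fin m → Carrier) (V : Fin m → Fin n → Carrier) →
    det n (updateAt M s (const (λ j → sumFin m (λ k → g k * V k j))))
      ≈ sumFin m (λ k → g k * det n (updateAt M s (const (V k))))
  det-rowCombination n M s zero    g V = det-zeroRow n M s _ (λ j → refl)
  det-rowCombination n M s (suc m) g V = begin
    det n (updateAt M s (const (λ j → g zero * V zero j + rest j)))
      ≈⟨ det-linear n M s _ (V zero) rest (g zero) 1# (λ j → +-congˡ (sym (*-identityˡ (rest j)))) ⟩
    g zero * det n (updateAt M s (const (V zero))) + 1# * det n (updateAt M s (const rest))
      ≈⟨ +-congˡ (trans (*-identityˡ _) (det-rowCombination n M s m (g ∘ suc) (V ∘ suc))) ⟩
    g zero * det n (updateAt M s (const (V zero))) + sumFin m (λ k → g (suc k) * det n (updateAt M s (const (V (suc k))))) ∎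
    where
    rest : Fin n → Carrier
    rest j = sumFin m (λ k → g (suc k) * V (suc k) j)

  offDiagonalRow : ∀ m → (Fin (suc m) → Fin (suc m) → Carrier) → Fin (suc m) → Carrier
  offDiagonalRow m F a = sumFin m (λ b → F a (punchIn a b))

  sumOffDiagonal : ∀ m → (Fin (suc m) → Fin (suc m) → Carrier) → Carrier
  sumOffDiagonal m F = sumFin (suc m) (offDiagonalRow m F)

  sumOffDiagonal-cong : ∀ m (F G : Fin (suc m) → Fin (suc m) → Carrier) → (∀ a c → F a c ≈ G a c) →
    sumOffDiagonal m F ≈ sumOffDiagonal m G
  sumOffDiagonal-cong m F G F≈G = sumFin-cong (suc m) (offDiagonalRow m F) (offDiagonalRow m G) λ a →
    sumFin-cong m _ _ λ b → F≈G a (punchIn a b)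

  -‿distrib-sumOffDiagonal : ∀ m (F : Fin (suc m) → Fin (suc m) → Carrier) →
    - sumOffDiagonal m F ≈ sumOffDiagonal m (λ a c → - F a c)
  -‿distrib-sumOffDiagonal m F = trans (-‿distrib-sumFin (suc m) (offDiagonalRow m F))
    (sumFin-cong (suc m) _ (offDiagonalRow m (λ a c → - F a c)) λ a → -‿distrib-sumFin m _)

  sumOffDiagonal-suc : ∀ m (F : Fin (suc (suc m)) → Fin (suc (suc m)) → Carrier) →
    sumOffDiagonal (suc m) F
      ≈ (sumFin (suc m) (λ c → F zero (suc c)) + sumFin (suc m) (λ a → F (suc a) zero)) + sumOffDiagonal m (λ a c → F (suc a) (suc c))
  sumOffDiagonal-suc m F = trans
    (+-congˡ (sumFin-distrib-+ (suc m) (λ a → F (suc a) zero) (λ a → sumFin m (λ b → F (suc a) (suc (punchIn a b))))))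
    (sym (+-assoc _ _ _))

  sumOffDiagonal-antisymmetric : ∀ m (F : Fin (suc m) → Fin (suc m) → Carrier) → (∀ a c → F a c + F c a ≈ 0#) →
    sumOffDiagonal m F ≈ 0#
  sumOffDiagonal-antisymmetric zero    F F-anti = +-identityˡ 0#
  sumOffDiagonal-antisymmetric (suc m) F F-anti = begin
    sumOffDiagonal (suc m) F
      ≈⟨ sumOffDiagonal-suc m F ⟩
    (sumFin (suc m) (λ c → F zero (suc c)) + sumFin (suc m) (λ a → F (suc a) zero)) + sumOffDiagonal m (λ a c → F (suc a) (suc c))
      ≈⟨ +-cong (sym (sumFin-distrib-+ (suc m) (λ c → F zero (suc c)) (λ c → F (suc c) zero)))
                (sumOffDiagonal-antisymmetric m _ λ a c → F-anti (suc a) (suc c)) ⟩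
    sumFin (suc m) (λ c → F zero (suc c) + F (suc c) zero) + 0#
      ≈⟨ +-identityʳ _ ⟩
    sumFin (suc m) (λ c → F zero (suc c) + F (suc c) zero)
      ≈⟨ sumFin-zero (suc m) _ (λ c → F-anti zero (suc c)) ⟩
    0# ∎

  sumOffDiagonal-transpose : ∀ m (F : Fin (suc m) → Fin (suc m) → Carrier) →
    sumOffDiagonal m (λ a c → F c a) ≈ sumOffDiagonal m F
  sumOffDiagonal-transpose zero    F = refl
  sumOffDiagonal-transpose (suc m) F = begin
    sumOffDiagonal (suc m) (λ a c → F c a)
      ≈⟨ sumOffDiagonal-suc m (λ a c → F c a) ⟩
    (sumFin (suc m) (λ c → F (suc c) zero) + sumFin (suc m) (λ a → F zero (suc a))) + sumOffDiagonal m (λ a c → F (suc c) (suc a))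
      ≈⟨ +-cong (+-comm _ _) (sumOffDiagonal-transpose m (λ a c → F (suc a) (suc c))) ⟩
    (sumFin (suc m) (λ a → F zero (suc a)) + sumFin (suc m) (λ c → F (suc c) zero)) + sumOffDiagonal m (λ a c → F (suc a) (suc c))
      ≈⟨ sumOffDiagonal-suc m F ⟨
    sumOffDiagonal (suc m) F ∎

  -- pairSign a c = (-1)^(a+b) where c = punchIn a b: the sign with which M₀ₐ M₁c occurs in the
  -- expansion along the first two rows.  It is antisymmetric, hence zero on the diagonal.
  pairSign : ∀ {m} → Fin m → Fin m → Carrier
  pairSign zero    zero    = 0#
  pairSign zero    (suc c) = sign (toℕ c)
  pairSign (suc a) zero    = - sign (toℕ a)
  pairSign (suc a) (suc c) = pairSign a c

  sign*sign≈pairSign : ∀ {m} (a : Fin (suc m)) (b : Fin m) → sign (toℕ a) * sign (toℕ b) ≈ pairSign a (punchIn a b)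
  sign*sign≈pairSign zero    b       = *-identityˡ _
  sign*sign≈pairSign (suc a) zero    = *-identityʳ _
  sign*sign≈pairSign (suc a) (suc b) = trans (solve 2 (λ x y → (:- x) :* (:- y) := x :* y) refl _ _) (sign*sign≈pairSign a b)

  pairSign-antisym : ∀ {m} (a c : Fin m) → pairSign c a ≈ - pairSign a c
  pairSign-antisym zero    zero    = sym -0#≈0#
  pairSign-antisym zero    (suc c) = refl
  pairSign-antisym (suc a) zero    = sym (-‿involutive _)
  pairSign-antisym (suc a) (suc c) = pairSign-antisym a c

  -- For a ≢ c, punchIn₂ a c enumerates the complement of {a, c} in increasing order.
  punchIn₂ : ∀ {n} → Fin (suc (suc n)) → Fin (suc (suc n)) → Fin n → Fin (suc (suc n))
  punchIn₂ zero    zero    l = suc (suc l)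
  punchIn₂ zero    (suc c) l = suc (punchIn c l)
  punchIn₂ (suc a) zero    l = suc (punchIn a l)
  punchIn₂ {suc n} (suc a) (suc c) zero    = zero
  punchIn₂ {suc n} (suc a) (suc c) (suc l) = suc (punchIn₂ a c l)

  punchIn-punchIn : ∀ {n} (a : Fin (suc (suc n))) (b : Fin (suc n)) l → punchIn a (punchIn b l) ≡ punchIn₂ a (punchIn a b) l
  punchIn-punchIn zero    b       l       = ≡.refl
  punchIn-punchIn (suc a) zero    l       = ≡.refl
  punchIn-punchIn {suc n} (suc a) (suc b) zero    = ≡.refl
  punchIn-punchIn {suc n} (suc a) (suc b) (suc l) = ≡.cong suc (punchIn-punchIn a b l)

  punchIn₂-comm : ∀ {n} (a c : Fin (suc (suc n))) l → punchIn₂ a c l ≡ punchIn₂ c a l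
  punchIn₂-comm zero    zero    l       = ≡.refl
  punchIn₂-comm zero    (suc c) l       = ≡.refl
  punchIn₂-comm (suc a) zero    l       = ≡.refl
  punchIn₂-comm {suc n} (suc a) (suc c) zero    = ≡.refl
  punchIn₂-comm {suc n} (suc a) (suc c) (suc l) = ≡.cong suc (punchIn₂-comm a c l)

  twoRowMinor : ∀ {n} → Fin (suc (suc n)) → Fin (suc (suc n)) → Matrix (suc (suc n)) → Matrix n
  twoRowMinor a c M i l = M (suc (suc i)) (punchIn₂ a c l)

  twoRowMinor-comm : ∀ n (a c : Fin (suc (suc n))) (M : Matrix (suc (suc n))) → det n (twoRowMinor a c M) ≈ det n (twoRowMinor c a M)
  twoRowMinor-comm n a c M = det-cong n (λ i l → reflexive (≡.cong (M (suc (suc i))) (punchIn₂-comm a c l)))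

  twoRowTerm : ∀ n → Matrix (suc (suc n)) → Fin (suc (suc n)) → Fin (suc (suc n)) → Carrier
  twoRowTerm n M a c = pairSign a c * (M zero a * M (suc zero) c) * det n (twoRowMinor a c M)

  det-expandTwoRows : ∀ n (M : Matrix (suc (suc n))) → det (suc (suc n)) M ≈ sumOffDiagonal (suc n) (twoRowTerm n M)
  det-expandTwoRows n M = sumFin-cong (suc (suc n)) (expansionTerm (suc n) M) (offDiagonalRow (suc n) (twoRowTerm n M)) λ a → begin
    sign (toℕ a) * M zero a * sumFin (suc n) (λ b → sign (toℕ b) * M (suc zero) (punchIn a b) * D a b)
      ≈⟨ *-distribˡ-sumFin (suc n) _ (λ b → sign (toℕ b) * M (suc zero) (punchIn a b) * D a b) ⟩
    sumFin (suc n) (λ b → sign (toℕ a) * M zero a * (sign (toℕ b) * M (suc zero) (punchIn a b) * D a b))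
      ≈⟨ sumFin-cong (suc n) _ (λ b → twoRowTerm n M a (punchIn a b)) (λ b → trans (regroup _ _ _ _ _)
           (*-cong (*-congʳ (sign*sign≈pairSign a b)) (det-cong n λ i l → reflexive (≡.cong (M (suc (suc i))) (punchIn-punchIn a b l))))) ⟩
    sumFin (suc n) (λ b → twoRowTerm n M a (punchIn a b)) ∎
    where
    D : Fin (suc (suc n)) → Fin (suc n) → Carrier
    D a b = det n (λ i l → M (suc (suc i)) (punchIn a (punchIn b l)))
    regroup : ∀ σ x τ y d → σ * x * (τ * y * d) ≈ σ * τ * (x * y) * d
    regroup = solve 5 (λ σ x τ y d → σ :* x :* (τ :* y :* d) := σ :* τ :* (x :* y) :* d) refl

  det-firstRowsEqual : ∀ n (M : Matrix (suc (suc n))) → (∀ j → M zero j ≈ M (suc zero) j) → det (suc (suc n)) M ≈ 0#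
  det-firstRowsEqual n M rows≈ = trans (det-expandTwoRows n M) (sumOffDiagonal-antisymmetric (suc n) (twoRowTerm n M) λ a c → begin
    pairSign a c * (M zero a * M (suc zero) c) * det n (twoRowMinor a c M) + pairSign c a * (M zero c * M (suc zero) a) * det n (twoRowMinor c a M)
      ≈⟨ +-cong (*-congʳ (*-congˡ (*-congˡ (sym (rows≈ c)))))
                (*-cong (*-cong (pairSign-antisym a c) (*-congˡ (sym (rows≈ a)))) (twoRowMinor-comm n c a M)) ⟩
    pairSign a c * (M zero a * M zero c) * det n (twoRowMinor a c M) + (- pairSign a c) * (M zero c * M zero a) * det n (twoRowMinor a c M)
      ≈⟨ solve 4 (λ σ x y d → σ :* (x :* y) :* d :+ (:- σ) :* (y :* x) :* d := :0) refl _ _ _ _ ⟩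
    0# ∎)

  swapFirstRows : ∀ {n} → Matrix (suc (suc n)) → Matrix (suc (suc n))
  swapFirstRows M zero          = M (suc zero)
  swapFirstRows M (suc zero)    = M zero
  swapFirstRows M (suc (suc i)) = M (suc (suc i))

  det-swapFirstRows : ∀ n (M : Matrix (suc (suc n))) → det (suc (suc n)) (swapFirstRows M) ≈ - det (suc (suc n)) M
  det-swapFirstRows n M = begin
    det (suc (suc n)) (swapFirstRows M)
      ≈⟨ det-expandTwoRows n (swapFirstRows M) ⟩
    sumOffDiagonal (suc n) (twoRowTerm n (swapFirstRows M))
      ≈⟨ sumOffDiagonal-cong (suc n) _ (λ a c → - twoRowTerm n M c a) (λ a c → begin
           pairSign a c * (M (suc zero) a * M zero c) * det n (twoRowMinor a c M)
             ≈⟨ *-cong (*-congʳ (pairSign-antisym c a)) (twoRowMinor-comm n a c M) ⟩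
           (- pairSign c a) * (M (suc zero) a * M zero c) * det n (twoRowMinor c a M)
             ≈⟨ solve 4 (λ σ x y d → (:- σ) :* (x :* y) :* d := :- (σ :* (y :* x) :* d)) refl _ _ _ _ ⟩
           - twoRowTerm n M c a ∎) ⟩
    sumOffDiagonal (suc n) (λ a c → - twoRowTerm n M c a)
      ≈⟨ -‿distrib-sumOffDiagonal (suc n) (λ a c → twoRowTerm n M c a) ⟨
    - sumOffDiagonal (suc n) (λ a c → twoRowTerm n M c a)
      ≈⟨ -‿cong (sumOffDiagonal-transpose (suc n) (twoRowTerm n M)) ⟩
    - sumOffDiagonal (suc n) (twoRowTerm n M)
      ≈⟨ -‿cong (det-expandTwoRows n M) ⟨
    - det (suc (suc n)) M ∎

  det-firstRowRepeated : ∀ n (M : Matrix (suc n)) t → (∀ j → M zero j ≈ M (suc t) j) → det (suc n) M ≈ 0#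
  det-firstRowRepeated (suc n) M zero    rows≈ = det-firstRowsEqual n M rows≈
  det-firstRowRepeated (suc n) M (suc t) rows≈ = begin
    det (suc (suc n)) M                   ≈⟨ -‿involutive _ ⟨
    - - det (suc (suc n)) M               ≈⟨ -‿cong (det-swapFirstRows n M) ⟨
    - det (suc (suc n)) (swapFirstRows M) ≈⟨ -‿cong (sumFin-zero (suc (suc n)) (expansionTerm (suc n) (swapFirstRows M)) λ j →
                                               trans (*-congˡ (det-firstRowRepeated n (minor j (swapFirstRows M)) t (rows≈ ∘ punchIn j))) (zeroʳ _)) ⟩
    - 0#                                  ≈⟨ -0#≈0# ⟩
    0#                                    ∎

  det-equalRows : ∀ n (M : Matrix n) r s → r ≢ s → (∀ j → M r j ≈ M s j) → det n M ≈ 0#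
  det-equalRows (suc n) M zero    zero    r≢s rows≈ = ⊥-elim (r≢s ≡.refl)
  det-equalRows (suc n) M zero    (suc t) r≢s rows≈ = det-firstRowRepeated n M t rows≈
  det-equalRows (suc n) M (suc t) zero    r≢s rows≈ = det-firstRowRepeated n M t (sym ∘ rows≈)
  det-equalRows (suc n) M (suc r) (suc s) r≢s rows≈ = sumFin-zero (suc n) (expansionTerm n M) λ j →
    trans (*-congˡ (det-equalRows n (minor j M) r s (r≢s ∘ ≡.cong suc) (rows≈ ∘ punchIn j))) (zeroʳ _)

  sumFin-punchIn : ∀ n (f : Fin (suc n) → Carrier) i → sumFin (suc n) f ≈ f i + sumFin n (f ∘ punchIn i)
  sumFin-punchIn n       f zero    = refl
  sumFin-punchIn (suc n) f (suc i) = begin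
    f zero + sumFin (suc n) (f ∘ suc)                     ≈⟨ +-congˡ (sumFin-punchIn n (f ∘ suc) i) ⟩
    f zero + (f (suc i) + sumFin n (f ∘ suc ∘ punchIn i)) ≈⟨ solve 3 (λ a b c → a :+ (b :+ c) := b :+ (a :+ c)) refl _ _ _ ⟩
    f (suc i) + (f zero + sumFin n (f ∘ suc ∘ punchIn i)) ∎

  det-addOtherRows : ∀ n (M : Matrix (suc n)) s (γ : Fin n → Carrier) →
    det (suc n) (updateAt M s (const (λ j → M s j + sumFin n (λ b → γ b * M (punchIn s b) j)))) ≈ det (suc n) M
  det-addOtherRows n M s γ = begin
    det (suc n) (updateAt M s (const (λ j → M s j + sumFin n (λ b → γ b * M (punchIn s b) j))))
      ≈⟨ det-linear (suc n) M s _ (M s) (λ j → sumFin n (λ b → γ b * M (punchIn s b) j)) 1# 1#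
           (λ j → sym (+-cong (*-identityˡ _) (*-identityˡ _))) ⟩
    1# * det (suc n) (updateAt M s (const (M s))) + 1# * det (suc n) (updateAt M s (const (λ j → sumFin n (λ b → γ b * M (punchIn s b) j))))
      ≈⟨ +-cong (trans (*-identityˡ _) (det-cong-≡ (suc n) (updateAt-id-local s M ≡.refl)))
                (trans (*-identityˡ _) (det-rowCombination (suc n) M s n γ (M ∘ punchIn s))) ⟩
    det (suc n) M + sumFin n (λ b → γ b * det (suc n) (updateAt M s (const (M (punchIn s b)))))
      ≈⟨ +-congˡ (sumFin-zero n _ λ b → trans (*-congˡ (repeatedRow b)) (zeroʳ _)) ⟩
    det (suc n) M + 0#
      ≈⟨ +-identityʳ _ ⟩
    det (suc n) M ∎
    where
    repeatedRow : ∀ b → det (suc n) (updateAt M s (const (M (punchIn s b)))) ≈ 0#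
    repeatedRow b = det-equalRows (suc n) M′ s (punchIn s b) (s≢t ∘ ≡.sym) λ j → reflexive (≡.cong-app rows≡ j)
      where
      M′ = updateAt M s (const (M (punchIn s b)))
      s≢t = Fin.punchInᵢ≢i s b
      rows≡ : M′ s ≡ M′ (punchIn s b)
      rows≡ = ≡.trans (updateAt-updates s M) (≡.sym (updateAt-minimal (punchIn s b) s M s≢t))

  infixl 7 _*ᴹ_
  _*ᴹ_ : ∀ {N} → Matrix N → Matrix N → Matrix N
  _*ᴹ_ {N} A B i j = sumFin N (λ k → A i k * B k j)

  -- Row m of L *ᴹ W is row m of W plus multiples of the other rows of W, where only rows above m
  -- have nonzero coefficients.  Replacing the rows of L *ᴹ W by those of W from the top down
  -- is therefore a sequence of determinant-preserving row operations.
  det-lowerUnitriangular-*ᴹ : ∀ N (L W : Matrix N) → (∀ i → L i i ≈ 1#) → (∀ i k → toℕ i ℕ.< toℕ k → L i k ≈ 0#) →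
    det N (L *ᴹ W) ≈ det N W
  det-lowerUnitriangular-*ᴹ zero    L W L-diag L-upper = refl
  det-lowerUnitriangular-*ᴹ (suc n) L W L-diag L-upper = begin
    det N (L *ᴹ W)    ≈⟨ det-cong N hybrid-zero ⟨
    det N (hybrid 0)  ≈⟨ det-hybrid-chain N ⟩
    det N (hybrid N)  ≈⟨ det-cong N hybrid-all ⟩
    det N W           ∎
    where
    N = suc n

    hybrid : ℕ → Matrix N
    hybrid m i with toℕ i ℕ.<? m
    ... | yes _ = W i
    ... | no _  = (L *ᴹ W) i

    hybrid-zero : ∀ i j → hybrid 0 i j ≈ (L *ᴹ W) i j
    hybrid-zero i j with toℕ i ℕ.<? 0
    ... | no _ = refl

    hybrid-all : ∀ i j → hybrid N i j ≈ W i j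
    hybrid-all i j with toℕ i ℕ.<? N
    ... | yes _  = refl
    ... | no i≮N = ⊥-elim (i≮N (Fin.toℕ<n i))

    hybrid-others : ∀ m i → toℕ i ≢ m → ∀ j → hybrid m i j ≈ hybrid (suc m) i j
    hybrid-others m i i≢m j with toℕ i ℕ.<? m | toℕ i ℕ.<? suc m
    ... | yes _   | yes _     = refl
    ... | yes i<m | no i≮1+m  = ⊥-elim (i≮1+m (ℕ.m<n⇒m<1+n i<m))
    ... | no i≮m  | yes i<1+m = ⊥-elim (i≮m (ℕ.≤∧≢⇒< (ℕ.≤-pred i<1+m) i≢m))
    ... | no _    | no _      = refl

    module Step (m : ℕ) (m<N : m ℕ.< N) where
      s : Fin N
      s = Fin.fromℕ< m<N

      s≡m : toℕ s ≡ m
      s≡m = Fin.toℕ-fromℕ< m<N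

      H : Matrix N
      H = hybrid (suc m)

      H-s : ∀ j → W s j ≈ H s j
      H-s j with toℕ s ℕ.<? suc m
      ... | yes _    = refl
      ... | no s≮1+m = ⊥-elim (s≮1+m (ℕ.≤-reflexive (≡.cong suc s≡m)))

      hybrid-s : ∀ j → hybrid m s j ≈ (L *ᴹ W) s j
      hybrid-s j with toℕ s ℕ.<? m
      ... | yes s<m = ⊥-elim (ℕ.<-irrefl s≡m s<m)
      ... | no _    = refl

      coefficient : ∀ k j → L s k * W k j ≈ L s k * H k j
      coefficient k j with toℕ k ℕ.<? suc m
      ... | yes _    = refl
      ... | no k≮1+m = trans (*-congʳ L-sk≈0) (trans (zeroˡ _) (sym (trans (*-congʳ L-sk≈0) (zeroˡ _))))
        where
        L-sk≈0 : L s k ≈ 0#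
        L-sk≈0 = L-upper s k (≡.subst (ℕ._< toℕ k) (≡.sym s≡m) (ℕ.≮⇒≥ k≮1+m))

      γ : Fin n → Carrier
      γ b = L s (punchIn s b)

      newRow : Fin N → Carrier
      newRow j = H s j + sumFin n (λ b → γ b * H (punchIn s b) j)

      row-s : ∀ j → hybrid m s j ≈ newRow j
      row-s j = begin
        hybrid m s j
          ≈⟨ hybrid-s j ⟩
        sumFin N (λ k → L s k * W k j)
          ≈⟨ sumFin-punchIn n (λ k → L s k * W k j) s ⟩
        L s s * W s j + sumFin n (λ b → γ b * W (punchIn s b) j)
          ≈⟨ +-cong (trans (*-congʳ (L-diag s)) (trans (*-identityˡ _) (H-s j)))
                    (sumFin-cong n _ _ λ b → coefficient (punchIn s b) j) ⟩
        newRow j ∎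

      as-rowOperation : ∀ i j → hybrid m i j ≈ updateAt H s (const newRow) i j
      as-rowOperation i j with i Fin.≟ s
      ... | yes ≡.refl = trans (row-s j) (reflexive (≡.sym (≡.cong-app (updateAt-updates s H) j)))
      ... | no i≢s     = trans (hybrid-others m i (λ i≡m → i≢s (Fin.toℕ-injective (≡.trans i≡m (≡.sym s≡m)))) j)
                               (reflexive (≡.sym (≡.cong-app (updateAt-minimal i s H i≢s) j)))

      det-step : det N (hybrid m) ≈ det N H
      det-step = trans (det-cong N as-rowOperation) (det-addOtherRows n H s γ)

    step : ∀ m → det N (hybrid m) ≈ det N (hybrid (suc m))
    step m with m ℕ.<? N
    ... | yes m<N = Step.det-step m m<N
    ... | no m≮N  = det-cong N λ i → hybrid-others m i λ i≡m → m≮N (≡.subst (ℕ._< N) i≡m (Fin.toℕ<n i))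

    det-hybrid-chain : ∀ m → det N (hybrid 0) ≈ det N (hybrid m)
    det-hybrid-chain zero    = refl
    det-hybrid-chain (suc m) = trans (det-hybrid-chain m) (step m)

  det-zeroColumn : ∀ n (M : Matrix n) c → (∀ i → M i c ≈ 0#) → det n M ≈ 0#
  det-minor-zeroColumn : ∀ n (M : Matrix (suc n)) {j c} → j ≢ c → (∀ i → M (suc i) c ≈ 0#) → det n (minor j M) ≈ 0#

  det-zeroColumn (suc n) M c column≈0 = sumFin-zero (suc n) (expansionTerm n M) term≈0
    where
    term≈0 : ∀ j → expansionTerm n M j ≈ 0#
    term≈0 j with j Fin.≟ c
    ... | yes ≡.refl = trans (*-congʳ (trans (*-congˡ (column≈0 zero)) (zeroʳ _))) (zeroˡ _)
    ... | no j≢c     = trans (*-congˡ (det-minor-zeroColumn n M j≢c (column≈0 ∘ suc))) (zeroʳ _)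

  det-minor-zeroColumn n M {j} j≢c column≈0 = det-zeroColumn n (minor j M) (Fin.punchOut j≢c) λ i →
    trans (reflexive (≡.cong (M (suc i)) (Fin.punchIn-punchOut j≢c))) (column≈0 i)

  prodTo-suc : ∀ n (f : ℕ → Carrier) → prodTo (suc n) f ≈ f 0 * prodTo n (f ∘ suc)
  prodTo-suc zero    f = trans (*-identityˡ _) (sym (*-identityʳ _))
  prodTo-suc (suc n) f = trans (*-congʳ (prodTo-suc n f)) (*-assoc _ _ _)

  det-upperTriangular : ∀ N (U : ℕ → ℕ → Carrier) → (∀ i j → j ℕ.< i → U i j ≈ 0#) →
    det N (λ i j → U (toℕ i) (toℕ j)) ≈ prodTo N (λ i → U i i)
  det-upperTriangular zero    U U-lower = refl
  det-upperTriangular (suc N) U U-lower = begin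
    expansionTerm N X zero + sumFin N (expansionTerm N X ∘ suc)
      ≈⟨ +-cong (*-cong (*-identityˡ _) (det-upperTriangular N (λ i j → U (suc i) (suc j)) (λ i j → U-lower (suc i) (suc j) ∘ ℕ.s<s)))
                (sumFin-zero N (expansionTerm N X ∘ suc) λ j →
                   trans (*-congˡ (det-minor-zeroColumn N X (λ ()) λ i → U-lower (suc (toℕ i)) 0 ℕ.z<s)) (zeroʳ _)) ⟩
    U 0 0 * prodTo N (λ i → U (suc i) (suc i)) + 0#
      ≈⟨ +-identityʳ _ ⟩
    U 0 0 * prodTo N (λ i → U (suc i) (suc i))
      ≈⟨ prodTo-suc N (λ i → U i i) ⟨
    prodTo (suc N) (λ i → U i i) ∎
    where
    X : Matrix (suc N)
    X i j = U (toℕ i) (toℕ j)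

module QCalculus {c ℓ} (R : CommutativeRing c ℓ) where
  open Over R
  open CommutativeRing R hiding (Carrier; _≈_; _+_; _*_; -_; _-_; 0#; 1#; zero)
  open IntegerRingSolver R using (solve; _:+_; _:*_; _:-_; _:=_; :0; :1)
  open import Relation.Binary.Reasoning.Setoid setoid

  sumTo-cong : ∀ n (f g : ℕ → Carrier) → (∀ i → i ℕ.< n → f i ≈ g i) → sumTo n f ≈ sumTo n g
  sumTo-cong zero    f g f≈g = refl
  sumTo-cong (suc n) f g f≈g = +-cong (sumTo-cong n f g (λ i → f≈g i ∘ ℕ.m<n⇒m<1+n)) (f≈g n (ℕ.n<1+n n))

  sumTo-distrib-+ : ∀ n (f g : ℕ → Carrier) → sumTo n (λ i → f i + g i) ≈ sumTo n f + sumTo n g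
  sumTo-distrib-+ zero    f g = sym (+-identityˡ 0#)
  sumTo-distrib-+ (suc n) f g = trans (+-congʳ (sumTo-distrib-+ n f g))
    (solve 4 (λ a b c d → (a :+ b) :+ (c :+ d) := (a :+ c) :+ (b :+ d)) refl _ _ _ _)

  sumTo-suc : ∀ n (f : ℕ → Carrier) → sumTo (suc n) f ≈ f 0 + sumTo n (f ∘ suc)
  sumTo-suc zero    f = trans (+-identityˡ _) (sym (+-identityʳ _))
  sumTo-suc (suc n) f = trans (+-congʳ (sumTo-suc n f)) (+-assoc _ _ _)

  sumTo-extend : ∀ m n (f : ℕ → Carrier) → m ℕ.≤ n → (∀ i → m ℕ.≤ i → f i ≈ 0#) → sumTo n f ≈ sumTo m f
  sumTo-extend m n f m≤n f≈0 with ℕ.m≤n⇒m<n∨m≡n m≤n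
  ... | inj₂ ≡.refl = refl
  ... | inj₁ (ℕ.s≤s {n = n-1} m≤n-1) = begin
    sumTo n-1 f + f n-1  ≈⟨ +-cong (sumTo-extend m n-1 f m≤n-1 f≈0) (f≈0 n-1 m≤n-1) ⟩
    sumTo m f + 0#       ≈⟨ +-identityʳ _ ⟩
    sumTo m f            ∎

  sumFin-toℕ : ∀ n (f : ℕ → Carrier) → sumFin n (f ∘ toℕ) ≈ sumTo n f
  sumFin-toℕ zero    f = refl
  sumFin-toℕ (suc n) f = trans (+-congˡ (sumFin-toℕ n (f ∘ suc))) (sym (sumTo-suc n f))

  pow-one : ∀ n → pow 1# n ≈ 1#
  pow-one zero    = refl
  pow-one (suc n) = trans (*-identityʳ _) (pow-one n)

  pow-+ : ∀ a m n → pow a (m ℕ.+ n) ≈ pow a m * pow a n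
  pow-+ a zero    n = sym (*-identityˡ _)
  pow-+ a (suc m) n = trans (*-congʳ (pow-+ a m n)) (solve 3 (λ u v w → u :* v :* w := u :* w :* v) refl _ _ _)

  pow-* : ∀ a b n → pow (a * b) n ≈ pow a n * pow b n
  pow-* a b zero    = sym (*-identityˡ _)
  pow-* a b (suc n) = trans (*-congʳ (pow-* a b n)) (solve 4 (λ u v w z → u :* v :* (w :* z) := u :* w :* (v :* z)) refl _ _ _ _)

  pow-congˡ : ∀ {a b} n → a ≈ b → pow a n ≈ pow b n
  pow-congˡ zero    a≈b = refl
  pow-congˡ (suc n) a≈b = *-cong (pow-congˡ n a≈b) a≈b

  pow-double : ∀ a n → pow a (2 ℕ.* n) ≈ pow a n * pow a n
  pow-double a n = trans (pow-+ a n (n ℕ.+ 0)) (*-congˡ (reflexive (≡.cong (pow a) (ℕ.+-identityʳ n))))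

  -- antidiagonal n h = Σ_{k + m = n} h k m
  antidiagonal : ℕ → (ℕ → ℕ → Carrier) → Carrier
  antidiagonal zero    h = h 0 0
  antidiagonal (suc n) h = h 0 (suc n) + antidiagonal n (λ k m → h (suc k) m)

  antidiagonal-cong : ∀ n (h h′ : ℕ → ℕ → Carrier) → (∀ k m → k ℕ.+ m ≡ n → h k m ≈ h′ k m) →
    antidiagonal n h ≈ antidiagonal n h′
  antidiagonal-cong zero    h h′ h≈h′ = h≈h′ 0 0 ≡.refl
  antidiagonal-cong (suc n) h h′ h≈h′ =
    +-cong (h≈h′ 0 (suc n) ≡.refl) (antidiagonal-cong n _ _ λ k m → h≈h′ (suc k) m ∘ ≡.cong suc)

  antidiagonal-distrib-+ : ∀ n (h h′ : ℕ → ℕ → Carrier) →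
    antidiagonal n (λ k m → h k m + h′ k m) ≈ antidiagonal n h + antidiagonal n h′
  antidiagonal-distrib-+ zero    h h′ = refl
  antidiagonal-distrib-+ (suc n) h h′ = trans (+-congˡ (antidiagonal-distrib-+ n _ _))
    (solve 4 (λ a b c d → (a :+ b) :+ (c :+ d) := (a :+ c) :+ (b :+ d)) refl _ _ _ _)

  *-distribˡ-antidiagonal : ∀ n a (h : ℕ → ℕ → Carrier) → a * antidiagonal n h ≈ antidiagonal n (λ k m → a * h k m)
  *-distribˡ-antidiagonal zero    a h = refl
  *-distribˡ-antidiagonal (suc n) a h = trans (distribˡ _ _ _) (+-congˡ (*-distribˡ-antidiagonal n a _))

  shiftFirst shiftSecond : (ℕ → ℕ → Carrier) → ℕ → ℕ → Carrier
  shiftFirst h zero    m = 0#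
  shiftFirst h (suc k) m = h k m
  shiftSecond h k zero    = 0#
  shiftSecond h k (suc m) = h k m

  antidiagonal-shiftFirst : ∀ n h → antidiagonal (suc n) (shiftFirst h) ≈ antidiagonal n h
  antidiagonal-shiftFirst n h = +-identityˡ _

  antidiagonal-shiftSecond : ∀ n h → antidiagonal (suc n) (shiftSecond h) ≈ antidiagonal n h
  antidiagonal-shiftSecond zero    h = +-identityʳ _
  antidiagonal-shiftSecond (suc n) h = +-congˡ (trans
    (antidiagonal-cong (suc n) _ (shiftSecond (λ k m → h (suc k) m)) split)
    (antidiagonal-shiftSecond n (λ k m → h (suc k) m)))
    where
    split : ∀ k m → k ℕ.+ m ≡ suc n → shiftSecond h (suc k) m ≈ shiftSecond (λ k m → h (suc k) m) k m
    split k zero    _ = refl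
    split k (suc m) _ = refl

  -- triangle h n k = h k (n ∸ k) for k ≤ n, and 0 above the diagonal
  triangle : (ℕ → ℕ → Carrier) → ℕ → ℕ → Carrier
  triangle h n       zero    = h zero n
  triangle h zero    (suc k) = 0#
  triangle h (suc n) (suc k) = triangle (λ k m → h (suc k) m) n k

  triangle-above : ∀ h n k → n ℕ.< k → triangle h n k ≈ 0#
  triangle-above h zero    (suc k) _           = refl
  triangle-above h (suc n) (suc k) (ℕ.s<s n<k) = triangle-above (λ k m → h (suc k) m) n k n<k

  triangle-diagonal : ∀ h n → triangle h n n ≈ h n 0
  triangle-diagonal h zero    = refl
  triangle-diagonal h (suc n) = triangle-diagonal (λ k m → h (suc k) m) n

  sumTo-triangle : ∀ n h (g : ℕ → Carrier) → sumTo (suc n) (λ k → triangle h n k * g k) ≈ antidiagonal n (λ k m → h k m * g k)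
  sumTo-triangle zero    h g = +-identityˡ _
  sumTo-triangle (suc n) h g = trans (sumTo-suc (suc n) (λ k → triangle h (suc n) k * g k))
    (+-congˡ (sumTo-triangle n (λ k m → h (suc k) m) (g ∘ suc)))

  module _ (q : Carrier) where

    qint-suc : ∀ n → qint q (suc n) ≈ 1# + q * qint q n
    qint-suc zero    = trans (+-identityˡ _) (sym (trans (+-congˡ (zeroʳ _)) (+-identityʳ _)))
    qint-suc (suc n) = begin
      qint q (suc n) + pow q (suc n)      ≈⟨ +-cong (qint-suc n) (*-comm _ _) ⟩
      (1# + q * qint q n) + q * pow q n   ≈⟨ solve 4 (λ o q a b → (o :+ q :* a) :+ q :* b := o :+ q :* (a :+ b)) refl _ _ _ _ ⟩
      1# + q * (qint q n + pow q n)       ∎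

    qint-+ : ∀ a b → qint q (a ℕ.+ b) ≈ qint q a + pow q a * qint q b
    qint-+ zero    b = sym (trans (+-identityˡ _) (*-identityˡ _))
    qint-+ (suc a) b = begin
      qint q (suc (a ℕ.+ b))                     ≈⟨ qint-suc (a ℕ.+ b) ⟩
      1# + q * qint q (a ℕ.+ b)                  ≈⟨ +-congˡ (*-congˡ (qint-+ a b)) ⟩
      1# + q * (qint q a + pow q a * qint q b)
        ≈⟨ solve 4 (λ q u p v → :1 :+ q :* (u :+ p :* v) := (:1 :+ q :* u) :+ p :* q :* v) refl q (qint q a) (pow q a) (qint q b) ⟩
      (1# + q * qint q a) + pow q (suc a) * qint q b ≈⟨ +-congʳ (qint-suc a) ⟨
      qint q (suc a) + pow q (suc a) * qint q b  ∎

    1-q*qint : ∀ n → (1# - q) * qint q n ≈ 1# - pow q n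
    1-q*qint zero    = trans (zeroʳ _) (solve 0 (:0 := :1 :- :1) refl)
    1-q*qint (suc n) = begin
      (1# - q) * (qint q n + pow q n)            ≈⟨ distribˡ _ _ _ ⟩
      (1# - q) * qint q n + (1# - q) * pow q n   ≈⟨ +-congʳ (1-q*qint n) ⟩
      (1# - pow q n) + (1# - q) * pow q n
        ≈⟨ solve 2 (λ q p → (:1 :- p) :+ (:1 :- q) :* p := :1 :- p :* q) refl q (pow q n) ⟩
      1# - pow q (suc n)                         ∎

    S-above : ∀ n k → n ℕ.< k → S q n k ≈ 0#
    S-above zero    (suc k) _           = refl
    S-above (suc n) (suc k) (ℕ.s<s n<k) = trans (+-cong (S-above n k n<k) (*-congˡ (S-above n (suc k) (ℕ.m<n⇒m<1+n n<k))))
      (trans (+-congˡ (zeroʳ _)) (+-identityʳ _))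

    S-diagonal : ∀ n → S q n n ≈ 1#
    S-diagonal zero    = refl
    S-diagonal (suc n) = trans (+-cong (S-diagonal n) (*-congˡ (S-above n (suc n) (ℕ.n<1+n n))))
      (trans (+-congˡ (zeroʳ _)) (+-identityʳ _))

    -- gauss k m is the Gaussian binomial coefficient [k+m choose k].
    gauss : ℕ → ℕ → Carrier
    gauss zero    m       = 1#
    gauss (suc k) zero    = 1#
    gauss (suc k) (suc m) = gauss k (suc m) + pow q (suc k) * gauss (suc k) m

    gauss-zeroʳ : ∀ k → gauss k 0 ≈ 1#
    gauss-zeroʳ zero    = refl
    gauss-zeroʳ (suc k) = refl

    gauss-oneˡ : ∀ m → gauss 1 m ≈ qint q (suc m)
    gauss-oneˡ zero    = sym (+-identityˡ _)
    gauss-oneˡ (suc m) = begin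
      1# + (1# * q) * gauss 1 m   ≈⟨ +-congˡ (*-cong (*-identityˡ q) (gauss-oneˡ m)) ⟩
      1# + q * qint q (suc m)     ≈⟨ qint-suc (suc m) ⟨
      qint q (suc (suc m))        ∎

    gauss-oneʳ : ∀ k → gauss k 1 ≈ qint q (suc k)
    gauss-oneʳ zero    = sym (+-identityˡ _)
    gauss-oneʳ (suc k) = +-cong (gauss-oneʳ k) (*-identityʳ _)

    qint-one : qint q 1 ≈ 1#
    qint-one = +-identityˡ 1#

    gauss-absorption : ∀ k m → qint q (suc m) * gauss k (suc m) ≈ qint q (suc k) * gauss (suc k) m
    gauss-absorption zero    m       = trans (*-identityʳ _) (sym (trans (*-congʳ qint-one) (trans (*-identityˡ _) (gauss-oneˡ m))))
    gauss-absorption (suc k) zero    = trans (*-congʳ qint-one) (trans (*-identityˡ _) (trans (gauss-oneʳ (suc k)) (sym (*-identityʳ _))))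
    gauss-absorption (suc k) (suc m) = begin
      m₂ * (a + P * g)
        ≈⟨ solve 4 (λ m₂ a P g → m₂ :* (a :+ P :* g) := m₂ :* a :+ P :* (m₂ :* g)) refl _ _ _ _ ⟩
      m₂ * a + P * (m₂ * g)
        ≈⟨ +-cong (gauss-absorption k (suc m)) (*-congˡ (*-congʳ (qint-suc (suc m)))) ⟩
      k₁ * g + P * ((1# + q * m₁) * g)
        ≈⟨ solve 5 (λ k₁ g P q m₁ → k₁ :* g :+ P :* ((:1 :+ q :* m₁) :* g) := (k₁ :+ P) :* g :+ (P :* q) :* (m₁ :* g)) refl _ _ _ _ _ ⟩
      (k₁ + P) * g + (P * q) * (m₁ * g)
        ≈⟨ +-congˡ (*-congˡ (gauss-absorption (suc k) m)) ⟩
      (k₁ + P) * g + (P * q) * (k₂ * b)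
        ≈⟨ solve 4 (λ k₂ g Pq b → k₂ :* g :+ Pq :* (k₂ :* b) := k₂ :* (g :+ Pq :* b)) refl _ _ _ _ ⟩
      k₂ * (g + pow q (suc (suc k)) * b) ∎
      where
      m₂ = qint q (suc (suc m))
      m₁ = qint q (suc m)
      k₁ = qint q (suc k)
      k₂ = qint q (suc (suc k))
      P = pow q (suc k)
      a = gauss k (suc (suc m))
      g = gauss (suc k) (suc m)
      b = gauss (suc (suc k)) m

    gauss-suc-suc : ∀ k m → gauss (suc k) (suc m) ≈ pow q (suc m) * gauss k (suc m) + gauss (suc k) m
    gauss-suc-suc k m = begin
      a + Pk * b
        ≈⟨ solve 4 (λ a b Pk Pm → a :+ Pk :* b := (Pm :* a :+ b) :+ ((:1 :- Pm) :* a :- (:1 :- Pk) :* b)) refl a b Pk Pm ⟩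
      (Pm * a + b) + ((1# - Pm) * a - (1# - Pk) * b)
        ≈⟨ +-congˡ (trans (+-congʳ same) (-‿inverseʳ _)) ⟩
      (Pm * a + b) + 0#
        ≈⟨ +-identityʳ _ ⟩
      Pm * a + b ∎
      where
      a = gauss k (suc m)
      b = gauss (suc k) m
      Pk = pow q (suc k)
      Pm = pow q (suc m)
      same : (1# - Pm) * a ≈ (1# - Pk) * b
      same = begin
        (1# - Pm) * a                     ≈⟨ *-congʳ (1-q*qint (suc m)) ⟨
        ((1# - q) * qint q (suc m)) * a   ≈⟨ *-assoc _ _ _ ⟩
        (1# - q) * (qint q (suc m) * a)   ≈⟨ *-congˡ (gauss-absorption k m) ⟩
        (1# - q) * (qint q (suc k) * b)   ≈⟨ *-assoc _ _ _ ⟨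
        ((1# - q) * qint q (suc k)) * b   ≈⟨ *-congʳ (1-q*qint (suc k)) ⟩
        (1# - Pk) * b                     ∎

    gauss-absorption′ : ∀ k m → qint q (suc m) * gauss k (suc m) ≈ qint q (k ℕ.+ suc m) * gauss k m
    gauss-absorption′ zero    m       = refl
    gauss-absorption′ (suc k) zero    = trans (*-congʳ qint-one) (trans (*-identityˡ _) (trans (gauss-oneʳ (suc k))
      (sym (trans (*-identityʳ _) (reflexive (≡.cong (qint q ∘ suc) (ℕ.+-comm k 1)))))))
    gauss-absorption′ (suc k) (suc m) = begin
      m₂ * (a + P * g)
        ≈⟨ solve 4 (λ m₂ a P g → m₂ :* (a :+ P :* g) := m₂ :* a :+ P :* (m₂ :* g)) refl _ _ _ _ ⟩
      m₂ * a + P * (m₂ * g)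
        ≈⟨ +-cong (gauss-absorption′ k (suc m)) (*-congˡ (*-congʳ (qint-suc (suc m)))) ⟩
      N₂ * a₁ + P * ((1# + q * m₁) * g)
        ≈⟨ solve 6 (λ N₂ a₁ P q m₁ g → N₂ :* a₁ :+ P :* ((:1 :+ q :* m₁) :* g) := N₂ :* a₁ :+ P :* (g :+ q :* (m₁ :* g))) refl _ _ _ _ _ _ ⟩
      N₂ * a₁ + P * (g + q * (m₁ * g))
        ≈⟨ +-congˡ (*-congˡ (+-cong (gauss-suc-suc k m) (*-congˡ (trans (gauss-absorption′ (suc k) m)
             (*-congʳ (reflexive (≡.cong (qint q) (≡.sym (ℕ.+-suc k (suc m)))))))))) ⟩
      N₂ * a₁ + P * ((Pm * a₁ + b) + q * (N₂ * b))
        ≈⟨ solve 6 (λ N₂ a₁ P Pm b q → N₂ :* a₁ :+ P :* ((Pm :* a₁ :+ b) :+ q :* (N₂ :* b))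
                                        := (N₂ :+ P :* Pm) :* a₁ :+ (:1 :+ q :* N₂) :* (P :* b)) refl _ _ _ _ _ _ ⟩
      (N₂ + P * Pm) * a₁ + (1# + q * N₂) * (P * b)
        ≈⟨ +-cong (*-congʳ (+-congˡ (sym powers))) (*-congʳ (sym (qint-suc (k ℕ.+ suc (suc m))))) ⟩
      (N₂ + pow q (k ℕ.+ suc (suc m))) * a₁ + N₃ * (P * b)
        ≈⟨ distribˡ _ _ _ ⟨
      N₃ * (a₁ + P * b) ∎
      where
      m₂ = qint q (suc (suc m))
      m₁ = qint q (suc m)
      P = pow q (suc k)
      Pm = pow q (suc m)
      a = gauss k (suc (suc m))
      a₁ = gauss k (suc m)
      g = gauss (suc k) (suc m)
      b = gauss (suc k) m
      N₂ = qint q (k ℕ.+ suc (suc m))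
      N₃ = qint q (suc (k ℕ.+ suc (suc m)))
      powers : pow q (k ℕ.+ suc (suc m)) ≈ P * Pm
      powers = trans (reflexive (≡.cong (pow q) (ℕ.+-suc k (suc m)))) (pow-+ q (suc k) (suc m))

    -- One step of the q-binomial theorem Σ_{k+m=n} [n choose k] z^m u_k = u₀ ∏_{i<n} (z + qⁱ w),
    -- for any sequence with u_{k+1} = q^k w u_k.
    q-binomial-step : ∀ z w (u : ℕ → Carrier) → (∀ k → u (suc k) ≈ pow q k * w * u k) → ∀ n →
      antidiagonal (suc n) (λ k m → gauss k m * pow z m * u k) ≈ (z + pow q n * w) * antidiagonal n (λ k m → gauss k m * pow z m * u k)
    q-binomial-step z w u u-suc n = sym (begin
      (z + pow q n * w) * Σ H
        ≈⟨ distribʳ _ _ _ ⟩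
      z * Σ H + (pow q n * w) * Σ H
        ≈⟨ +-cong (*-distribˡ-antidiagonal n z H) (*-distribˡ-antidiagonal n (pow q n * w) H) ⟩
      antidiagonal n zH + antidiagonal n wH
        ≈⟨ +-cong (antidiagonal-shiftSecond n zH) (antidiagonal-shiftFirst n wH) ⟨
      antidiagonal (suc n) (shiftSecond zH) + antidiagonal (suc n) (shiftFirst wH)
        ≈⟨ antidiagonal-distrib-+ (suc n) (shiftSecond zH) (shiftFirst wH) ⟨
      antidiagonal (suc n) (λ k m → shiftSecond zH k m + shiftFirst wH k m)
        ≈⟨ antidiagonal-cong (suc n) _ H pascal ⟩
      antidiagonal (suc n) H ∎)
      where
      H zH wH : ℕ → ℕ → Carrier
      H k m = gauss k m * pow z m * u k
      zH k m = z * H k m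
      wH k m = (pow q n * w) * H k m
      Σ = antidiagonal n
      pascal : ∀ k m → k ℕ.+ m ≡ suc n → shiftSecond zH k m + shiftFirst wH k m ≈ H k m
      pascal zero    zero    ()
      pascal zero    (suc m) _ = solve 3 (λ z p u → z :* (:1 :* p :* u) :+ :0 := :1 :* (p :* z) :* u) refl z (pow z m) (u 0)
      pascal (suc k) zero    k+0≡n = begin
        0# + pow q n * w * (gauss k 0 * 1# * u k)
          ≈⟨ +-congˡ (*-congˡ (*-congʳ (*-congʳ (gauss-zeroʳ k)))) ⟩
        0# + pow q n * w * (1# * 1# * u k)
          ≈⟨ solve 3 (λ Q w u → :0 :+ Q :* w :* (:1 :* :1 :* u) := :1 :* :1 :* (Q :* w :* u)) refl _ _ _ ⟩
        1# * 1# * (pow q n * w * u k)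
          ≈⟨ *-congˡ (*-congʳ (*-congʳ (reflexive (≡.cong (pow q) (≡.sym k≡n))))) ⟩
        1# * 1# * (pow q k * w * u k)
          ≈⟨ *-congˡ (u-suc k) ⟨
        1# * 1# * u (suc k) ∎
        where
        k≡n : k ≡ n
        k≡n = ℕ.suc-injective (≡.trans (≡.sym (ℕ.+-identityʳ (suc k))) k+0≡n)
      pascal (suc k) (suc m) k+m≡n = begin
        z * (gauss (suc k) m * pow z m * u (suc k)) + pow q n * w * (gauss k (suc m) * (pow z m * z) * u k)
          ≈⟨ +-cong (*-congˡ (*-congˡ (u-suc k))) (*-congʳ (*-congʳ powers)) ⟩
        z * (gauss (suc k) m * pow z m * (pow q k * w * u k)) + pow q k * pow q (suc m) * w * (gauss k (suc m) * (pow z m * z) * u k)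
          ≈⟨ solve 8 (λ z G₁ zm Qk w uk Pm G₂ → z :* (G₁ :* zm :* (Qk :* w :* uk)) :+ Qk :* Pm :* w :* (G₂ :* (zm :* z) :* uk)
                                                := (Pm :* G₂ :+ G₁) :* (zm :* z) :* (Qk :* w :* uk)) refl z _ _ _ w _ _ _ ⟩
        (pow q (suc m) * gauss k (suc m) + gauss (suc k) m) * (pow z m * z) * (pow q k * w * u k)
          ≈⟨ *-cong (*-congʳ (gauss-suc-suc k m)) (u-suc k) ⟨
        gauss (suc k) (suc m) * (pow z m * z) * u (suc k) ∎
        where
        powers : pow q n ≈ pow q k * pow q (suc m)
        powers = trans (reflexive (≡.cong (pow q) (≡.sym (ℕ.suc-injective k+m≡n)))) (pow-+ q k (suc m))

module HankelDeterminant {c ℓ} (R : CommutativeRing c ℓ) (q x : CommutativeRing.Carrier R) where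
  open Over R
  open CommutativeRing R hiding (Carrier; _≈_; _+_; _*_; -_; _-_; 0#; 1#; zero)
  open IntegerRingSolver R using (solve; _:+_; _:*_; :-_; _:-_; _:=_; :0; :1)
  open Determinant R
  open QCalculus R
  open import Relation.Binary.Reasoning.Setoid setoid

  -- The recurrence in j mirrors S[n+1, k] = S[n, k-1] + [k] S[n, k]; it turns Σ_k S[i, k] moment k (j + 1)
  -- into Σ_k S[i + 1, k] moment k j, so that Σ_k S[i, k] moment k j = Φ_{i+j}.
  moment : ℕ → ℕ → Carrier
  moment k zero    = pow q (k C 2) * pow x k
  moment k (suc j) = moment (suc k) j + qint q k * moment k j

  Φ-stirlingSum : ∀ j i → sumTo (suc i) (λ k → S q i k * moment k j) ≈ Φ q (i ℕ.+ j) x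
  Φ-stirlingSum zero    i = begin
    sumTo (suc i) (λ k → S q i k * moment k zero)
      ≈⟨ sumTo-cong (suc i) _ _ (λ k _ → solve 3 (λ s a b → s :* (a :* b) := a :* s :* b) refl _ _ _) ⟩
    Φ q i x                ≡⟨ ≡.cong (λ n → Φ q n x) (≡.sym (ℕ.+-identityʳ i)) ⟩
    Φ q (i ℕ.+ zero) x     ∎
  Φ-stirlingSum (suc j) i = begin
    sumTo (suc i) (λ k → S q i k * (moment (suc k) j + qint q k * moment k j))
      ≈⟨ sumTo-cong (suc i) _ (λ k → S q i k * moment (suc k) j + g k)
           (λ k _ → solve 4 (λ s a t b → s :* (a :+ t :* b) := s :* a :+ t :* s :* b) refl _ _ _ _) ⟩
    sumTo (suc i) (λ k → S q i k * moment (suc k) j + g k)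
      ≈⟨ sumTo-distrib-+ (suc i) _ g ⟩
    sumTo (suc i) (λ k → S q i k * moment (suc k) j) + sumTo (suc i) g
      ≈⟨ +-congˡ g-shift ⟩
    sumTo (suc i) (λ k → S q i k * moment (suc k) j) + sumTo (suc i) (g ∘ suc)
      ≈⟨ sumTo-distrib-+ (suc i) _ _ ⟨
    sumTo (suc i) (λ k → S q i k * moment (suc k) j + g (suc k))
      ≈⟨ sumTo-cong (suc i) _ _ (λ k _ → solve 4 (λ s a t u → s :* a :+ t :* u :* a := (s :+ t :* u) :* a) refl _ _ _ _) ⟩
    sumTo (suc i) (λ k → S q (suc i) (suc k) * moment (suc k) j)
      ≈⟨ trans (+-congʳ (zeroˡ _)) (+-identityˡ _) ⟨
    S q (suc i) 0 * moment 0 j + sumTo (suc i) (λ k → S q (suc i) (suc k) * moment (suc k) j)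
      ≈⟨ sumTo-suc (suc i) (λ k → S q (suc i) k * moment k j) ⟨
    sumTo (suc (suc i)) (λ k → S q (suc i) k * moment k j)
      ≈⟨ Φ-stirlingSum j (suc i) ⟩
    Φ q (suc i ℕ.+ j) x  ≡⟨ ≡.cong (λ n → Φ q n x) (≡.sym (ℕ.+-suc i j)) ⟩
    Φ q (i ℕ.+ suc j) x  ∎
    where
    g : ℕ → Carrier
    g k = qint q k * S q i k * moment k j
    -- the term k = i + 1 vanishes, and so does the term k = 0 because [0] = 0
    g-shift : sumTo (suc i) g ≈ sumTo (suc i) (g ∘ suc)
    g-shift = begin
      sumTo (suc i) g                ≈⟨ +-identityʳ _ ⟨
      sumTo (suc i) g + 0#           ≈⟨ +-congˡ (trans (*-congʳ (trans (*-congˡ (S-above q i (suc i) (ℕ.n<1+n i))) (zeroʳ _))) (zeroˡ _)) ⟨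
      sumTo (suc (suc i)) g          ≈⟨ sumTo-suc (suc i) g ⟩
      g 0 + sumTo (suc i) (g ∘ suc)  ≈⟨ +-congʳ (trans (*-congʳ (zeroˡ _)) (zeroˡ _)) ⟩
      0# + sumTo (suc i) (g ∘ suc)   ≈⟨ +-identityˡ _ ⟩
      sumTo (suc i) (g ∘ suc)        ∎

  suc-C2 : ∀ t → suc t C 2 ≡ t ℕ.+ t C 2
  suc-C2 t = ≡.trans (≡.sym (nCk+nC[k+1]≡[n+1]C[k+1] t 1)) (≡.cong (ℕ._+ t C 2) (nC1≡n t))

  suc-C3 : ∀ t → suc t C 3 ≡ t C 2 ℕ.+ t C 3
  suc-C3 t = ≡.sym (nCk+nC[k+1]≡[n+1]C[k+1] t 2)

  diagonalFactor : ℕ → Carrier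
  diagonalFactor n = qfact q n * qpoch q ((1# - q) * x) n

  -- The moment matrix, shifted by s rows, is triangularised by a lower unitriangular matrix with
  -- entries A k m at position (k + m, k); U is the resulting upper triangular matrix.
  module Triangularisation (s : ℕ) where

    ζ : ℕ → Carrier
    ζ zero    = 1#
    ζ (suc n) = - x * pow q (n ℕ.+ s)

    A : ℕ → ℕ → Carrier
    A k m = gauss q k m * pow (ζ (k ℕ.+ m)) m

    Mₛ : ℕ → ℕ → Carrier
    Mₛ k j = moment (k ℕ.+ s) j

    U : ℕ → ℕ → Carrier
    U n j = antidiagonal n (λ k m → A k m * Mₛ k j)

    ω : ℕ → Carrier
    ω n = ζ n * (1# - q) + pow q s

    β γ : ℕ → Carrier
    β n = qint q n * ω n + qint q s - pow q (suc n) * ζ n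
    γ n = - (pow q n * ζ (suc n) * qint q (suc n) * ω (suc n))

    qA : ℕ → ℕ → Carrier
    qA k m = qint q (k ℕ.+ s) * A k m

    antidiagonal-shiftSecond-weighted : ∀ n (f : ℕ → ℕ → Carrier) (w : ℕ → Carrier) →
      antidiagonal n (λ k m → f k m * w k) ≈ antidiagonal (suc n) (λ k m → shiftSecond f k m * w k)
    antidiagonal-shiftSecond-weighted n f w = trans (sym (antidiagonal-shiftSecond n (λ k m → f k m * w k)))
      (antidiagonal-cong (suc n) _ _ shifted)
      where
      shifted : ∀ k m → k ℕ.+ m ≡ suc n → shiftSecond (λ k m → f k m * w k) k m ≈ shiftSecond f k m * w k
      shifted k zero    _ = sym (zeroˡ _)
      shifted k (suc m) _ = refl

    U-suc : ∀ n j → U n (suc j) ≈ antidiagonal (suc n) (λ k m → (shiftFirst A k m + shiftSecond qA k m) * Mₛ k j)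
    U-suc n j = begin
      antidiagonal n (λ k m → A k m * (Mₛ (suc k) j + qint q (k ℕ.+ s) * Mₛ k j))
        ≈⟨ antidiagonal-cong n _ _ (λ k m _ → solve 4 (λ f a t b → f :* (a :+ t :* b) := f :* a :+ t :* f :* b) refl _ _ _ _) ⟩
      antidiagonal n (λ k m → A k m * Mₛ (suc k) j + qA k m * Mₛ k j)
        ≈⟨ antidiagonal-distrib-+ n (λ k m → A k m * Mₛ (suc k) j) (λ k m → qA k m * Mₛ k j) ⟩
      antidiagonal n (λ k m → A k m * Mₛ (suc k) j) + antidiagonal n (λ k m → qA k m * Mₛ k j)
        ≈⟨ +-cong (antidiagonal-shiftFirst n (λ k m → A k m * Mₛ (suc k) j)) (antidiagonal-shiftSecond n (λ k m → qA k m * Mₛ k j)) ⟨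
      antidiagonal (suc n) (shiftFirst (λ k m → A k m * Mₛ (suc k) j)) + antidiagonal (suc n) (shiftSecond (λ k m → qA k m * Mₛ k j))
        ≈⟨ antidiagonal-distrib-+ (suc n) (shiftFirst (λ k m → A k m * Mₛ (suc k) j)) (shiftSecond (λ k m → qA k m * Mₛ k j)) ⟨
      antidiagonal (suc n) (λ k m → shiftFirst (λ k m → A k m * Mₛ (suc k) j) k m + shiftSecond (λ k m → qA k m * Mₛ k j) k m)
        ≈⟨ antidiagonal-cong (suc n) _ _ (λ k m _ → factor k m) ⟩
      antidiagonal (suc n) (λ k m → (shiftFirst A k m + shiftSecond qA k m) * Mₛ k j) ∎
      where
      factor : ∀ k m → shiftFirst (λ k m → A k m * Mₛ (suc k) j) k m + shiftSecond (λ k m → qA k m * Mₛ k j) k m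
                         ≈ (shiftFirst A k m + shiftSecond qA k m) * Mₛ k j
      factor zero    zero    = solve 1 (λ c → :0 :+ :0 := (:0 :+ :0) :* c) refl _
      factor zero    (suc m) = solve 2 (λ b c → :0 :+ b :* c := (:0 :+ b) :* c) refl _ _
      factor (suc k) zero    = solve 2 (λ a c → a :* c :+ :0 := (a :+ :0) :* c) refl _ _
      factor (suc k) (suc m) = sym (distribʳ _ _ _)

    ζ-suc : ∀ n → ζ (suc (suc n)) ≈ ζ (suc n) * q
    ζ-suc n = sym (*-assoc _ _ _)

    pow-ζ : ∀ n k m → k ℕ.+ m ≡ n → pow q n * ζ (suc n) * pow (ζ n) m ≈ pow q k * pow (ζ (suc n)) (suc m)
    pow-ζ n k zero k+0≡n = begin
      pow q n * ζ (suc n) * 1#   ≈⟨ *-congʳ (*-congʳ (reflexive (≡.cong (pow q) (≡.trans (≡.sym k+0≡n) (ℕ.+-identityʳ k))))) ⟩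
      pow q k * ζ (suc n) * 1#   ≈⟨ solve 2 (λ a z → a :* z :* :1 := a :* (:1 :* z)) refl _ _ ⟩
      pow q k * (1# * ζ (suc n)) ∎
    pow-ζ zero    k (suc m) k+m≡0 = ⊥-elim (ℕ.0≢1+n (≡.sym (≡.trans (≡.sym (ℕ.+-suc k m)) k+m≡0)))
    pow-ζ (suc n) k (suc m) k+m≡n = begin
      pow q (suc n) * ζ (suc (suc n)) * pow Z (suc m)   ≈⟨ *-congʳ (*-congˡ (ζ-suc n)) ⟩
      pow q (suc n) * (Z * q) * pow Z (suc m)           ≈⟨ solve 4 (λ P Z q Zm → P :* (Z :* q) :* Zm := P :* q :* (Zm :* Z)) refl _ _ _ _ ⟩
      pow q (suc n) * q * (pow Z (suc m) * Z)           ≈⟨ *-congʳ powers ⟨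
      pow q k * pow q (suc (suc m)) * pow Z (suc (suc m))
        ≈⟨ solve 3 (λ a b c → a :* b :* c := a :* (c :* b)) refl _ _ _ ⟩
      pow q k * (pow Z (suc (suc m)) * pow q (suc (suc m))) ≈⟨ *-congˡ (pow-* Z q (suc (suc m))) ⟨
      pow q k * pow (Z * q) (suc (suc m))               ≈⟨ *-congˡ (pow-congˡ (suc (suc m)) (ζ-suc n)) ⟨
      pow q k * pow (ζ (suc (suc n))) (suc (suc m))     ∎
      where
      Z = ζ (suc n)
      powers : pow q k * pow q (suc (suc m)) ≈ pow q (suc n) * q
      powers = trans (sym (pow-+ q k (suc (suc m)))) (reflexive (≡.cong (pow q) (≡.trans (ℕ.+-suc k (suc m)) (≡.cong suc k+m≡n))))

    pow-ζ-suc : ∀ n m → pow (ζ (suc (suc n))) m ≈ pow (ζ (suc n)) m * pow q m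
    pow-ζ-suc n m = trans (pow-congˡ m (ζ-suc n)) (pow-* _ q m)

    A-suc-shiftFirst : ∀ n k m → k ℕ.+ m ≡ suc n →
      A k (suc m) + gauss q k m * pow (ζ (suc n)) m * ζ (suc n) * ((1# - q) * qint q k - pow q (suc (suc n))) ≈ shiftFirst A k (suc m)
    A-suc-shiftFirst n zero .(suc n) ≡.refl = begin
      1# * pow (ζ (suc (suc n))) (suc (suc n)) + 1# * pow Z (suc n) * Z * ((1# - q) * 0# - pow q (suc (suc n)))
        ≈⟨ +-congʳ (*-congˡ (pow-ζ-suc n (suc (suc n)))) ⟩
      1# * (pow Z (suc n) * Z * pow q (suc (suc n))) + 1# * pow Z (suc n) * Z * ((1# - q) * 0# - pow q (suc (suc n)))
        ≈⟨ solve 4 (λ Zm Z q Q → :1 :* (Zm :* Z :* Q) :+ :1 :* Zm :* Z :* ((:1 :- q) :* :0 :- Q)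
                               := :0) refl _ _ _ _ ⟩
      0# ∎
      where
      Z = ζ (suc n)
    A-suc-shiftFirst .(k ℕ.+ m) (suc k) m ≡.refl = begin
      (a + Pk * g) * pow (ζ (suc (k ℕ.+ suc m))) (suc m) + g * pow Z m * Z * ((1# - q) * K - pow q (suc (suc (k ℕ.+ m))))
        ≈⟨ +-cong (*-congˡ (trans (reflexive (≡.cong (λ t → pow (ζ (suc t)) (suc m)) (ℕ.+-suc k m))) (pow-ζ-suc (k ℕ.+ m) (suc m))))
                  (*-congˡ (+-congˡ (-‿cong powers))) ⟩
      (a + Pk * g) * (pow Z m * Z * Qm) + g * pow Z m * Z * ((1# - q) * K - Pk * Qm)
        ≈⟨ solve 8 (λ a Pk g Zm Z Qm q K → (a :+ Pk :* g) :* (Zm :* Z :* Qm) :+ g :* Zm :* Z :* ((:1 :- q) :* K :- Pk :* Qm)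
                                            := a :* Zm :* Z :* Qm :+ Zm :* Z :* ((:1 :- q) :* (K :* g))) refl a Pk g (pow Z m) Z Qm q K ⟩
      a * pow Z m * Z * Qm + pow Z m * Z * ((1# - q) * (K * g))
        ≈⟨ +-congˡ (*-congˡ absorbed) ⟩
      a * pow Z m * Z * Qm + pow Z m * Z * ((1# - Qm) * a)
        ≈⟨ solve 4 (λ a Zm Z Q → a :* Zm :* Z :* Q :+ Zm :* Z :* ((:1 :- Q) :* a) := a :* (Zm :* Z)) refl a (pow Z m) Z Qm ⟩
      a * pow Z (suc m)
        ≈⟨ *-congˡ (reflexive (≡.cong (λ t → pow (ζ t) (suc m)) (ℕ.+-suc k m))) ⟨
      a * pow (ζ (k ℕ.+ suc m)) (suc m) ∎
      where
      Z = ζ (suc (k ℕ.+ m))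
      a = gauss q k (suc m)
      g = gauss q (suc k) m
      K = qint q (suc k)
      Pk = pow q (suc k)
      Qm = pow q (suc m)
      powers : pow q (suc (suc (k ℕ.+ m))) ≈ Pk * Qm
      powers = trans (reflexive (≡.cong (pow q ∘ suc) (≡.sym (ℕ.+-suc k m)))) (pow-+ q (suc k) (suc m))
      absorbed : (1# - q) * (K * g) ≈ (1# - Qm) * a
      absorbed = begin
        (1# - q) * (K * g)                ≈⟨ *-congˡ (gauss-absorption q k m) ⟨
        (1# - q) * (qint q (suc m) * a)   ≈⟨ *-assoc _ _ _ ⟨
        ((1# - q) * qint q (suc m)) * a   ≈⟨ *-congʳ (1-q*qint q (suc m)) ⟩
        (1# - Qm) * a                     ∎

    γ-shiftSecond : ∀ n k m → k ℕ.+ m ≡ suc n →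
      γ n * shiftSecond A k m ≈ - (ω (suc n) * pow q k * qint q m * (gauss q k m * pow (ζ (suc n)) m))
    γ-shiftSecond n k zero    _     = solve 4 (λ l w Q t → l :* :0 := :- (w :* Q :* :0 :* t)) refl _ _ _ _
    γ-shiftSecond n k (suc m) k+m≡n = begin
      - (pow q n * Z * qint q N * ω N) * (gauss q k m * pow (ζ (k ℕ.+ m)) m)
        ≈⟨ *-congˡ (*-congˡ (reflexive (≡.cong (λ t → pow (ζ t) m) k+m≡n′))) ⟩
      - (pow q n * Z * qint q N * ω N) * (gauss q k m * pow (ζ n) m)
        ≈⟨ solve 6 (λ Q Z Nq W g p → :- (Q :* Z :* Nq :* W) :* (g :* p) := :- (W :* (Nq :* g) :* (Q :* Z :* p))) refl _ _ _ _ _ _ ⟩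
      - (ω N * (qint q N * gauss q k m) * (pow q n * Z * pow (ζ n) m))
        ≈⟨ -‿cong (*-cong (*-congˡ (trans (*-congʳ (reflexive (≡.cong (qint q) (≡.sym k+m≡n)))) (sym (gauss-absorption′ q k m))))
                          (pow-ζ n k m k+m≡n′)) ⟩
      - (ω N * (qint q (suc m) * gauss q k (suc m)) * (pow q k * pow Z (suc m)))
        ≈⟨ solve 5 (λ W Mq g Qk Zp → :- (W :* (Mq :* g) :* (Qk :* Zp)) := :- (W :* Qk :* Mq :* (g :* Zp))) refl _ _ _ _ _ ⟩
      - (ω N * pow q k * qint q (suc m) * (gauss q k (suc m) * pow Z (suc m))) ∎
      where
      N = suc n
      Z = ζ N
      k+m≡n′ : k ℕ.+ m ≡ n
      k+m≡n′ = ℕ.suc-injective (≡.trans (≡.sym (ℕ.+-suc k m)) k+m≡n)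

    threeTerm-coefficients : ∀ n k m → k ℕ.+ m ≡ suc n →
      A k (suc m) + β (suc n) * A k m + γ n * shiftSecond A k m ≈ shiftFirst A k (suc m) + qA k m
    threeTerm-coefficients n k m k+m≡n = begin
      A k (suc m) + β N * A k m + γ n * shiftSecond A k m
        ≈⟨ +-cong (+-congˡ (*-cong β-split A-diag)) (γ-shiftSecond n k m k+m≡n) ⟩
      A₁ + ((K + Qk * Km) * (Z * (1# - q) + Qs) + Ks - QN * Z) * T + - ((Z * (1# - q) + Qs) * Qk * Km * T)
        ≈⟨ solve 10 (λ A₁ K Qk Km Z q Qs Ks QN T →
                       A₁ :+ ((K :+ Qk :* Km) :* (Z :* (:1 :- q) :+ Qs) :+ Ks :- QN :* Z) :* T :+ :- ((Z :* (:1 :- q) :+ Qs) :* Qk :* Km :* T)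
                       := (A₁ :+ T :* Z :* ((:1 :- q) :* K :- QN)) :+ (Ks :+ Qs :* K) :* T) refl A₁ K Qk Km Z q Qs Ks QN T ⟩
      (A₁ + T * Z * ((1# - q) * K - QN)) + (Ks + Qs * K) * T
        ≈⟨ +-cong (A-suc-shiftFirst n k m k+m≡n) (*-cong Ks+QsK (sym A-diag)) ⟩
      shiftFirst A k (suc m) + qA k m ∎
      where
      N = suc n
      Z = ζ N
      T = gauss q k m * pow Z m
      A₁ = A k (suc m)
      K = qint q k
      Km = qint q m
      Qk = pow q k
      Qs = pow q s
      Ks = qint q s
      QN = pow q (suc N)
      A-diag : A k m ≈ T
      A-diag = *-congˡ (reflexive (≡.cong (λ t → pow (ζ t) m) k+m≡n))
      β-split : β N ≈ (K + Qk * Km) * (Z * (1# - q) + Qs) + Ks - QN * Z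
      β-split = +-congʳ (+-congʳ (*-congʳ (trans (reflexive (≡.cong (qint q) (≡.sym k+m≡n))) (qint-+ q k m))))
      Ks+QsK : Ks + Qs * K ≈ qint q (k ℕ.+ s)
      Ks+QsK = trans (sym (qint-+ q s k)) (reflexive (≡.cong (qint q) (ℕ.+-comm s k)))

    U-threeTerm : ∀ n j → U (suc n) (suc j) ≈ U (suc (suc n)) j + β (suc n) * U (suc n) j + γ n * U n j
    U-threeTerm n j = begin
      U (suc n) (suc j)
        ≈⟨ U-suc (suc n) j ⟩
      Σ (λ k m → (shiftFirst A k m + shiftSecond qA k m) * Mₛ k j)
        ≈⟨ antidiagonal-cong (suc (suc n)) _ (λ k m → f₀ k m + b * f₁ k m + l * f₂ k m) regroup ⟩
      Σ (λ k m → f₀ k m + b * f₁ k m + l * f₂ k m)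
        ≈⟨ antidiagonal-distrib-+ (suc (suc n)) (λ k m → f₀ k m + b * f₁ k m) (λ k m → l * f₂ k m) ⟩
      Σ (λ k m → f₀ k m + b * f₁ k m) + Σ (λ k m → l * f₂ k m)
        ≈⟨ +-congʳ (antidiagonal-distrib-+ (suc (suc n)) f₀ (λ k m → b * f₁ k m)) ⟩
      Σ f₀ + Σ (λ k m → b * f₁ k m) + Σ (λ k m → l * f₂ k m)
        ≈⟨ +-cong (+-congˡ (*-distribˡ-antidiagonal (suc (suc n)) b f₁)) (*-distribˡ-antidiagonal (suc (suc n)) l f₂) ⟨
      Σ f₀ + b * Σ f₁ + l * Σ f₂
        ≈⟨ +-cong (+-congˡ (*-congˡ (antidiagonal-shiftSecond-weighted (suc n) A (λ k → Mₛ k j))))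
                  (*-congˡ (trans (antidiagonal-shiftSecond-weighted n A (λ k → Mₛ k j))
                                  (antidiagonal-shiftSecond-weighted (suc n) (shiftSecond A) (λ k → Mₛ k j)))) ⟨
      U (suc (suc n)) j + b * U (suc n) j + l * U n j ∎
      where
      b = β (suc n)
      l = γ n
      Σ = antidiagonal (suc (suc n))
      f₀ f₁ f₂ : ℕ → ℕ → Carrier
      f₀ k m = A k m * Mₛ k j
      f₁ k m = shiftSecond A k m * Mₛ k j
      f₂ k m = shiftSecond (shiftSecond A) k m * Mₛ k j
      regroup : ∀ k m → k ℕ.+ m ≡ suc (suc n) →
        (shiftFirst A k m + shiftSecond qA k m) * Mₛ k j ≈ f₀ k m + b * f₁ k m + l * f₂ k m
      regroup zero    zero    ()
      regroup (suc k) zero    _ = trans (*-congʳ (+-congʳ (*-congʳ (gauss-zeroʳ q k))))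
        (solve 3 (λ b l c → (:1 :* :1 :+ :0) :* c
                            := (:1 :* :1 :* c :+ b :* (:0 :* c)) :+ l :* (:0 :* c)) refl b l (Mₛ (suc k) j))
      regroup k       (suc m) k+m≡n = begin
        (shiftFirst A k (suc m) + qA k m) * Mₛ k j
          ≈⟨ *-congʳ (threeTerm-coefficients n k m (ℕ.suc-injective (≡.trans (≡.sym (ℕ.+-suc k m)) k+m≡n))) ⟨
        (A k (suc m) + b * A k m + l * shiftSecond A k m) * Mₛ k j
          ≈⟨ solve 6 (λ a₁ b a l a₀ c → (a₁ :+ b :* a :+ l :* a₀) :* c := a₁ :* c :+ b :* (a :* c) :+ l :* (a₀ :* c)) refl _ _ _ _ _ _ ⟩
        (A k (suc m) * Mₛ k j + b * (A k m * Mₛ k j)) + l * (shiftSecond A k m * Mₛ k j) ∎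

    Mₛ-suc : ∀ k → Mₛ (suc k) 0 ≈ pow q k * (pow q s * x) * Mₛ k 0
    Mₛ-suc k = begin
      pow q (suc t C 2) * (pow x t * x)         ≈⟨ *-congʳ (trans (reflexive (≡.cong (pow q) (suc-C2 t))) (pow-+ q t (t C 2))) ⟩
      pow q t * pow q (t C 2) * (pow x t * x)   ≈⟨ *-congʳ (*-congʳ (pow-+ q k s)) ⟩
      pow q k * pow q s * pow q (t C 2) * (pow x t * x)
        ≈⟨ solve 5 (λ a b c d x → a :* b :* c :* (d :* x) := a :* (b :* x) :* (c :* d)) refl _ _ _ _ _ ⟩
      pow q k * (pow q s * x) * (pow q (t C 2) * pow x t) ∎
      where
      t = k ℕ.+ s

    -- By the q-binomial theorem, row n + 1 of A annihilates the first column of the moments,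
    -- because ζ (n + 1) = - qⁿ (qˢ x).
    U-firstColumn : ∀ n → U (suc n) 0 ≈ 0#
    U-firstColumn n = begin
      U (suc n) 0
        ≈⟨ antidiagonal-cong (suc n) _ H (λ k m k+m≡n → *-congʳ (*-congˡ (reflexive (≡.cong (λ t → pow (ζ t) m) k+m≡n)))) ⟩
      antidiagonal (suc n) H
        ≈⟨ q-binomial-step q z (pow q s * x) (λ k → Mₛ k 0) Mₛ-suc n ⟩
      (z + pow q n * (pow q s * x)) * antidiagonal n H
        ≈⟨ *-congʳ z+qⁿqˢx≈0 ⟩
      0# * antidiagonal n H
        ≈⟨ zeroˡ _ ⟩
      0# ∎
      where
      z = ζ (suc n)
      H : ℕ → ℕ → Carrier
      H k m = gauss q k m * pow z m * Mₛ k 0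
      z+qⁿqˢx≈0 : z + pow q n * (pow q s * x) ≈ 0#
      z+qⁿqˢx≈0 = begin
        - x * pow q (n ℕ.+ s) + pow q n * (pow q s * x)     ≈⟨ +-congʳ (*-congˡ (pow-+ q n s)) ⟩
        - x * (pow q n * pow q s) + pow q n * (pow q s * x) ≈⟨ solve 3 (λ x a b → (:- x) :* (a :* b) :+ a :* (b :* x) := :0) refl _ _ _ ⟩
        0# ∎

    U-upperTriangular : ∀ j n → j ℕ.< n → U n j ≈ 0#
    U-upperTriangular zero    (suc n)       _              = U-firstColumn n
    U-upperTriangular (suc j) (suc (suc n)) (ℕ.s<s j<1+n) = begin
      U (suc (suc n)) (suc j)
        ≈⟨ U-threeTerm (suc n) j ⟩
      U (suc (suc (suc n))) j + β (suc (suc n)) * U (suc (suc n)) j + γ (suc n) * U (suc n) j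
        ≈⟨ +-cong (+-cong (U-upperTriangular j _ (ℕ.m<n⇒m<1+n (ℕ.m<n⇒m<1+n j<1+n)))
                          (*-congˡ (U-upperTriangular j _ (ℕ.m<n⇒m<1+n j<1+n))))
                  (*-congˡ (U-upperTriangular j _ j<1+n)) ⟩
      0# + β (suc (suc n)) * 0# + γ (suc n) * 0#
        ≈⟨ solve 2 (λ a b → :0 :+ a :* :0 :+ b :* :0 := :0) refl _ _ ⟩
      0# ∎

    U-diagonal-suc : ∀ n → U (suc n) (suc n) ≈ γ n * U n n
    U-diagonal-suc n = begin
      U (suc n) (suc n)
        ≈⟨ U-threeTerm n n ⟩
      U (suc (suc n)) n + β (suc n) * U (suc n) n + γ n * U n n
        ≈⟨ +-congʳ (+-cong (U-upperTriangular n _ (ℕ.m<n⇒m<1+n (ℕ.n<1+n n))) (*-congˡ (U-upperTriangular n _ (ℕ.n<1+n n)))) ⟩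
      0# + β (suc n) * 0# + γ n * U n n
        ≈⟨ solve 3 (λ a b c → :0 :+ a :* :0 :+ b :* c := b :* c) refl _ _ _ ⟩
      γ n * U n n ∎

    γ-closedForm : ∀ n → γ n ≈ pow q n * pow q n * (pow q s * pow q s) * x * qint q (suc n) * (1# - pow q n * ((1# - q) * x))
    γ-closedForm n = begin
      - (pow q n * (- x * pow q (n ℕ.+ s)) * qint q (suc n) * (- x * pow q (n ℕ.+ s) * (1# - q) + pow q s))
        ≈⟨ -‿cong (*-cong (*-congʳ (*-congˡ (*-congˡ (pow-+ q n s)))) (+-congʳ (*-congʳ (*-congˡ (pow-+ q n s))))) ⟩
      - (pow q n * (- x * (pow q n * pow q s)) * qint q (suc n) * (- x * (pow q n * pow q s) * (1# - q) + pow q s))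
        ≈⟨ solve 5 (λ Qn Qs x K q → :- (Qn :* ((:- x) :* (Qn :* Qs)) :* K :* ((:- x) :* (Qn :* Qs) :* (:1 :- q) :+ Qs))
                                     := (Qn :* Qn :* (Qs :* Qs)) :* x :* K :* (:1 :- Qn :* ((:1 :- q) :* x))) refl _ _ _ _ _ ⟩
      pow q n * pow q n * (pow q s * pow q s) * x * qint q (suc n) * (1# - pow q n * ((1# - q) * x)) ∎

    U-diagonal : ∀ n → U n n ≈ Mₛ 0 0 * (pow q (n C 2) * pow q (n C 2) * (pow (pow q s) n * pow (pow q s) n) * pow x n * diagonalFactor n)
    U-diagonal zero    = solve 1 (λ m → :1 :* :1 :* m
                                        := m :* (:1 :* :1 :* (:1 :* :1) :* :1 :* (:1 :* :1))) refl _
    U-diagonal (suc n) = begin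
      U (suc n) (suc n)
        ≈⟨ U-diagonal-suc n ⟩
      γ n * U n n
        ≈⟨ *-cong (γ-closedForm n) (U-diagonal n) ⟩
      pow q n * pow q n * (Qs * Qs) * x * K * B * (Mₛ 0 0 * (Q₂ * Q₂ * (P * P) * X * (F * Pc)))
        ≈⟨ solve 11 (λ M Qn C Qs P X x K B F Pc → Qn :* Qn :* (Qs :* Qs) :* x :* K :* B :* (M :* (C :* C :* (P :* P) :* X :* (F :* Pc)))
                                                  := M :* ((Qn :* C) :* (Qn :* C) :* ((P :* Qs) :* (P :* Qs)) :* (X :* x) :* ((F :* K) :* (Pc :* B))))
                   refl (Mₛ 0 0) (pow q n) Q₂ Qs P X x K B F Pc ⟩
      Mₛ 0 0 * ((pow q n * Q₂) * (pow q n * Q₂) * (pow Qs (suc n) * pow Qs (suc n)) * pow x (suc n) * diagonalFactor (suc n))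
        ≈⟨ *-congˡ (*-congʳ (*-congʳ (*-congʳ (*-cong C-suc C-suc)))) ⟨
      Mₛ 0 0 * (pow q (suc n C 2) * pow q (suc n C 2) * (pow Qs (suc n) * pow Qs (suc n)) * pow x (suc n) * diagonalFactor (suc n)) ∎
      where
      Qs = pow q s
      Q₂ = pow q (n C 2)
      P = pow Qs n
      X = pow x n
      K = qint q (suc n)
      B = 1# - pow q n * ((1# - q) * x)
      F = qfact q n
      Pc = qpoch q ((1# - q) * x) n
      C-suc : pow q (suc n C 2) ≈ pow q n * Q₂
      C-suc = trans (reflexive (≡.cong (pow q) (suc-C2 n))) (pow-+ q n (n C 2))

    U-diagonalProduct : ∀ N → prodTo N (λ n → U n n)
      ≈ pow (Mₛ 0 0) N * (pow q (N C 3) * pow q (N C 3) * (pow (pow q s) (N C 2) * pow (pow q s) (N C 2)) * pow x (N C 2) * prodTo N diagonalFactor)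
    U-diagonalProduct zero    = solve 0 (:1 := :1 :* (:1 :* :1 :* (:1 :* :1) :* :1 :* :1)) refl
    U-diagonalProduct (suc N) = begin
      prodTo N (λ n → U n n) * U N N
        ≈⟨ *-cong (U-diagonalProduct N) (U-diagonal N) ⟩
      pow M N * (C3 * C3 * (S2 * S2) * X2 * Π) * (M * (C2 * C2 * (SN * SN) * XN * d))
        ≈⟨ solve 10 (λ M Mp C3 C2 S2 SN X2 XN Π d → Mp :* (C3 :* C3 :* (S2 :* S2) :* X2 :* Π) :* (M :* (C2 :* C2 :* (SN :* SN) :* XN :* d))
                                                       := (Mp :* M) :* ((C2 :* C3) :* (C2 :* C3) :* ((SN :* S2) :* (SN :* S2)) :* (XN :* X2) :* (Π :* d)))
                   refl M (pow M N) C3 C2 S2 SN X2 XN Π d ⟩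
      pow M (suc N) * ((C2 * C3) * (C2 * C3) * ((SN * S2) * (SN * S2)) * (XN * X2) * prodTo (suc N) diagonalFactor)
        ≈⟨ *-congˡ (*-congʳ (*-cong (*-cong (*-cong C3-suc C3-suc) (*-cong S2-suc S2-suc)) X2-suc)) ⟨
      pow M (suc N) * (pow q (suc N C 3) * pow q (suc N C 3) * (pow Qs (suc N C 2) * pow Qs (suc N C 2)) * pow x (suc N C 2) * prodTo (suc N) diagonalFactor) ∎
      where
      M = Mₛ 0 0
      Qs = pow q s
      C3 = pow q (N C 3)
      C2 = pow q (N C 2)
      S2 = pow Qs (N C 2)
      SN = pow Qs N
      X2 = pow x (N C 2)
      XN = pow x N
      Π = prodTo N diagonalFactor
      d = diagonalFactor N
      C3-suc : pow q (suc N C 3) ≈ C2 * C3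
      C3-suc = trans (reflexive (≡.cong (pow q) (suc-C3 N))) (pow-+ q (N C 2) (N C 3))
      S2-suc : pow Qs (suc N C 2) ≈ SN * S2
      S2-suc = trans (reflexive (≡.cong (pow Qs) (suc-C2 N))) (pow-+ Qs N (N C 2))
      X2-suc : pow x (suc N C 2) ≈ XN * X2
      X2-suc = trans (reflexive (≡.cong (pow x) (suc-C2 N))) (pow-+ x N (N C 2))

    det-momentMatrix : ∀ N → det N (λ k j → Mₛ (toℕ k) (toℕ j)) ≈ prodTo N (λ n → U n n)
    det-momentMatrix N = begin
      det N Mm                            ≈⟨ det-lowerUnitriangular-*ᴹ N T Mm T-diagonal (λ i k → triangle-above A (toℕ i) (toℕ k)) ⟨
      det N (T *ᴹ Mm)                     ≈⟨ det-cong N entry ⟩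
      det N (λ i j → U (toℕ i) (toℕ j))   ≈⟨ det-upperTriangular N U (λ i j → U-upperTriangular j i) ⟩
      prodTo N (λ n → U n n)              ∎
      where
      Mm T : Matrix N
      Mm k j = Mₛ (toℕ k) (toℕ j)
      T i k = triangle A (toℕ i) (toℕ k)
      T-diagonal : ∀ i → T i i ≈ 1#
      T-diagonal i = trans (triangle-diagonal A (toℕ i)) (trans (*-identityʳ _) (gauss-zeroʳ q (toℕ i)))
      entry : ∀ i j → (T *ᴹ Mm) i j ≈ U (toℕ i) (toℕ j)
      entry i j = begin
        sumFin N (λ k → triangle A (toℕ i) (toℕ k) * Mₛ (toℕ k) (toℕ j))
          ≈⟨ sumFin-toℕ N (λ k → triangle A (toℕ i) k * Mₛ k (toℕ j)) ⟩
        sumTo N (λ k → triangle A (toℕ i) k * Mₛ k (toℕ j))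
          ≈⟨ sumTo-extend (suc (toℕ i)) N _ (Fin.toℕ<n i) (λ k i<k → trans (*-congʳ (triangle-above A (toℕ i) k i<k)) (zeroˡ _)) ⟩
        sumTo (suc (toℕ i)) (λ k → triangle A (toℕ i) k * Mₛ k (toℕ j))
          ≈⟨ sumTo-triangle (toℕ i) A (λ k → Mₛ k (toℕ j)) ⟩
        U (toℕ i) (toℕ j) ∎

  open Triangularisation using (U; Mₛ; U-diagonalProduct; det-momentMatrix)

  stirlingMatrix momentMatrix : ∀ s N → Matrix N
  stirlingMatrix s N i k = S q (toℕ i ℕ.+ s) (toℕ k ℕ.+ s)
  momentMatrix s N k j = Mₛ s (toℕ k) (toℕ j)

  det-stirling-*ᴹ-moments : ∀ s N (H : Matrix N) → (∀ i j → H i j ≈ (stirlingMatrix s N *ᴹ momentMatrix s N) i j) →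
    det N H ≈ prodTo N (λ n → U s n n)
  det-stirling-*ᴹ-moments s N H H≈SM = begin
    det N H
      ≈⟨ det-cong N H≈SM ⟩
    det N (stirlingMatrix s N *ᴹ momentMatrix s N)
      ≈⟨ det-lowerUnitriangular-*ᴹ N _ _ (λ i → S-diagonal q (toℕ i ℕ.+ s)) (λ i k i<k → S-above q _ _ (ℕ.+-monoˡ-< s i<k)) ⟩
    det N (momentMatrix s N)
      ≈⟨ det-momentMatrix s N ⟩
    prodTo N (λ n → U s n n) ∎

  Φ-stirlingSum-upTo : ∀ j i N → i ℕ.< N → sumTo N (λ k → S q i k * moment k j) ≈ Φ q (i ℕ.+ j) x
  Φ-stirlingSum-upTo j i N i<N = trans (sumTo-extend (suc i) N _ i<N λ k i<k → trans (*-congʳ (S-above q i k i<k)) (zeroˡ _))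
    (Φ-stirlingSum j i)

  hankel₀-factorisation : ∀ N (i j : Fin N) → Φ q (toℕ i ℕ.+ toℕ j) x ≈ (stirlingMatrix 0 N *ᴹ momentMatrix 0 N) i j
  hankel₀-factorisation N i j = sym (begin
    sumFin N (λ k → S q (toℕ i ℕ.+ 0) (toℕ k ℕ.+ 0) * moment (toℕ k ℕ.+ 0) (toℕ j))
      ≈⟨ sumFin-toℕ N (λ k → S q (toℕ i ℕ.+ 0) (k ℕ.+ 0) * moment (k ℕ.+ 0) (toℕ j)) ⟩
    sumTo N (λ k → S q (toℕ i ℕ.+ 0) (k ℕ.+ 0) * moment (k ℕ.+ 0) (toℕ j))
      ≈⟨ sumTo-cong N _ _ (λ k _ → reflexive (≡.cong₂ (λ a b → S q a b * moment b (toℕ j)) (ℕ.+-identityʳ (toℕ i)) (ℕ.+-identityʳ k))) ⟩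
    sumTo N (λ k → S q (toℕ i) k * moment k (toℕ j))
      ≈⟨ Φ-stirlingSum-upTo (toℕ j) (toℕ i) N (Fin.toℕ<n i) ⟩
    Φ q (toℕ i ℕ.+ toℕ j) x ∎)

  -- Since S[i+1, 0] = 0, the shifted Hankel matrix factors through S[i+1, k+1] alone.
  hankel₁-factorisation : ∀ N (i j : Fin N) → Φ q (toℕ i ℕ.+ toℕ j ℕ.+ 1) x ≈ (stirlingMatrix 1 N *ᴹ momentMatrix 1 N) i j
  hankel₁-factorisation N i j = sym (begin
    sumFin N (λ k → S q (toℕ i ℕ.+ 1) (toℕ k ℕ.+ 1) * moment (toℕ k ℕ.+ 1) (toℕ j))
      ≈⟨ sumFin-toℕ N (λ k → S q (toℕ i ℕ.+ 1) (k ℕ.+ 1) * moment (k ℕ.+ 1) (toℕ j)) ⟩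
    sumTo N (λ k → S q (toℕ i ℕ.+ 1) (k ℕ.+ 1) * moment (k ℕ.+ 1) (toℕ j))
      ≈⟨ sumTo-cong N _ _ (λ k _ → reflexive (≡.cong₂ (λ a b → S q a b * moment b (toℕ j)) (ℕ.+-comm (toℕ i) 1) (ℕ.+-comm k 1))) ⟩
    sumTo N (λ k → S q (suc (toℕ i)) (suc k) * moment (suc k) (toℕ j))
      ≈⟨ trans (sumTo-suc N (λ k → S q (suc (toℕ i)) k * moment k (toℕ j))) (trans (+-congʳ (zeroˡ _)) (+-identityˡ _)) ⟨
    sumTo (suc N) (λ k → S q (suc (toℕ i)) k * moment k (toℕ j))
      ≈⟨ Φ-stirlingSum-upTo (toℕ j) (suc (toℕ i)) (suc N) (ℕ.s<s (Fin.toℕ<n i)) ⟩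
    Φ q (suc (toℕ i) ℕ.+ toℕ j) x
      ≡⟨ ≡.cong (λ t → Φ q t x) (ℕ.+-comm 1 (toℕ i ℕ.+ toℕ j)) ⟩
    Φ q (toℕ i ℕ.+ toℕ j ℕ.+ 1) x ∎)

  det-hankel : ∀ N → det N (λ i j → Φ q (toℕ i ℕ.+ toℕ j) x) ≈ pow q (2 ℕ.* (N C 3)) * pow x (N C 2) * prodTo N diagonalFactor
  det-hankel N = begin
    det N (λ i j → Φ q (toℕ i ℕ.+ toℕ j) x)
      ≈⟨ det-stirling-*ᴹ-moments 0 N _ (hankel₀-factorisation N) ⟩
    prodTo N (λ n → U 0 n n)
      ≈⟨ U-diagonalProduct 0 N ⟩
    pow (1# * 1#) N * (C₃ * C₃ * (pow 1# (N C 2) * pow 1# (N C 2)) * pow x (N C 2) * Π)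
      ≈⟨ *-cong (trans (pow-congˡ N (*-identityˡ 1#)) (pow-one N)) (*-congʳ (*-congʳ (*-congˡ (*-cong (pow-one (N C 2)) (pow-one (N C 2)))))) ⟩
    1# * (C₃ * C₃ * (1# * 1#) * pow x (N C 2) * Π)
      ≈⟨ solve 3 (λ c X p → :1 :* (c :* c :* (:1 :* :1) :* X :* p) := c :* c :* X :* p) refl C₃ (pow x (N C 2)) Π ⟩
    C₃ * C₃ * pow x (N C 2) * Π
      ≈⟨ *-congʳ (*-congʳ (pow-double q (N C 3))) ⟨
    pow q (2 ℕ.* (N C 3)) * pow x (N C 2) * Π ∎
    where
    C₃ = pow q (N C 3)
    Π = prodTo N diagonalFactor

  det-hankel-shifted : ∀ N → det N (λ i j → Φ q (toℕ i ℕ.+ toℕ j ℕ.+ 1) x) ≈ pow q (2 ℕ.* (suc N C 3)) * pow x (suc N C 2) * prodTo N diagonalFactor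
  det-hankel-shifted N = begin
    det N (λ i j → Φ q (toℕ i ℕ.+ toℕ j ℕ.+ 1) x)
      ≈⟨ det-stirling-*ᴹ-moments 1 N _ (hankel₁-factorisation N) ⟩
    prodTo N (λ n → U 1 n n)
      ≈⟨ U-diagonalProduct 1 N ⟩
    pow (1# * (1# * x)) N * (C₃ * C₃ * (pow (1# * q) (N C 2) * pow (1# * q) (N C 2)) * pow x (N C 2) * Π)
      ≈⟨ *-cong (pow-congˡ N (trans (*-identityˡ _) (*-identityˡ x)))
                (*-congʳ (*-congʳ (*-congˡ (*-cong (pow-congˡ (N C 2) (*-identityˡ q)) (pow-congˡ (N C 2) (*-identityˡ q)))))) ⟩
    pow x N * (C₃ * C₃ * (C₂ * C₂) * pow x (N C 2) * Π)
      ≈⟨ solve 5 (λ X c d Y p → X :* (c :* c :* (d :* d) :* Y :* p) := (d :* c) :* (d :* c) :* (X :* Y) :* p) refl (pow x N) C₃ C₂ (pow x (N C 2)) Π ⟩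
    (C₂ * C₃) * (C₂ * C₃) * (pow x N * pow x (N C 2)) * Π
      ≈⟨ *-congʳ (*-cong (trans (pow-double q (suc N C 3)) (*-cong C₃-suc C₃-suc)) X₂-suc) ⟨
    pow q (2 ℕ.* (suc N C 3)) * pow x (suc N C 2) * Π ∎
    where
    C₃ = pow q (N C 3)
    C₂ = pow q (N C 2)
    Π = prodTo N diagonalFactor
    C₃-suc : pow q (suc N C 3) ≈ C₂ * C₃
    C₃-suc = trans (reflexive (≡.cong (pow q) (suc-C3 N))) (pow-+ q (N C 2) (N C 3))
    X₂-suc : pow x (suc N C 2) ≈ pow x N * pow x (N C 2)
    X₂-suc = trans (reflexive (≡.cong (pow x) (suc-C2 N))) (pow-+ x N (N C 2))

theorem2 : ∀ {c ℓ : Level} (R : CommutativeRing c ℓ) → let open Over R in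
    (q x : Carrier) (n : ℕ) → 1 ≤ n →
      (det n (λ i j → Φ q (toℕ i N.+ toℕ j) x)
         ≈ pow q (2 N.* (n C 3)) * pow x (n C 2)
           * prodTo n (λ j → qfact q j * qpoch q ((1# - q) * x) j))
      × (det n (λ i j → Φ q (toℕ i N.+ toℕ j N.+ 1) x)
         ≈ pow q (2 N.* (suc n C 3)) * pow x (suc n C 2)
           * prodTo n (λ j → qfact q j * qpoch q ((1# - q) * x) j))
theorem2 R q x n _ = det-hankel n , det-hankel-shifted n
  where open HankelDeterminant R q x
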